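{- Let $q$ and $q+1$ both be prime powers and let $N_\beta$ ($\beta\in\mathbb{F}_{q+1}^*$) be as in the context. Define $A_0=I_{(q+1)q^2}$, $A_1=I_{q+1}\otimes I_q\otimes(J_q-I_q)$, $A_2=I_{q+1}\otimes(J_q-I_q)\otimes J_q$, $A_3=(J_{q+1}-I_{q+1})\otimes I_{q^2}$, $A_4=(J_{q+1}-I_{q+1})\otimes I_q\otimes(J_q-I_q)$, and $A_{5,\beta}=N_\beta-A_3$ for $\beta\in\mathbb{F}_{q+1}^*$. Then $A_0,A_1,A_2,A_3,A_4,A_{5,\beta}$ ($\beta\in\mathbb{F}_{q+1}^*$) form a commutative association scheme with $q+4$ classes.
   Context: $I_n,J_n$ are the identity and all-ones matrices of order $n$, $\mathbb{F}_r^*=\mathbb{F}_r\setminus\{0\}$, $\otimes$ is the Kronecker product. Let $x$ be a new symbol and fix a bijection $\varphi:\mathbb{F}_{q+1}\to\mathbb{F}_q\cup\{x\}$ with $\varphi(0)=x$. Matrices of order $(q+1)q^2$ have rows and columns indexed by $\mathbb{F}_{q+1}\times\mathbb{F}_q\times\mathbb{F}_q$ in lexicographic order (compatible with Kronecker products). For $\beta\in\mathbb{F}_{q+1}^*$, $N_\beta$ is the $(0,1)$-matrix whose $((b,a_1,a_2),(b',a_1',a_2'))$-entry is $1$ if $c=\varphi(\beta(b'-b))$ lies in $\mathbb{F}_q$ and $a_2'-a_2=c(a_1'-a_1)$, and $0$ otherwise. A family of nonzero $(0,1)$-matrices $A_0,\dots,A_n$ indexed by a finite set $X$ forms a commutative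 association scheme with $n$ classes if: $A_0=I_{|X|}$; $\sum_iA_i=J_{|X|}$; for each $i\geq1$, $A_i^\top\in\{A_1,\dots,A_n\}$; each $A_iA_j$ is a linear combination of $A_0,\dots,A_n$; and $A_iA_j=A_jA_i$ for all $i,j$. -}

module Defs where

open import Level using (0ℓ)
open import Data.Nat using (ℕ; suc)
open import Data.Integer using (ℤ; 0ℤ; 1ℤ) renaming (_+_ to _+ℤ_; _*_ to _*ℤ_; _-_ to _-ℤ_)
open import Data.Bool using (Bool; true; false)
open import Data.Product using (_×_; _,_; Σ; ∃; ∃-syntax)
open import Data.Sum using (_⊎_)
open import Data.Maybe using (Maybe; just; nothing)
open import Data.List using (List; []; _∷_; length; foldr; map; cartesianProduct; concatMap)
open import Data.List.Membership.Propositional using (_∈_)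
open import Data.List.Relation.Unary.Unique.Propositional using (Unique)
open import Relation.Nullary using (¬_; Dec; yes; no)
open import Relation.Nullary.Decidable using (False; fromWitnessFalse)
open import Data.Product.Properties using (≡-dec)
open import Relation.Binary.PropositionalEquality using (_≡_)
open import Algebra.Structures using (IsCommutativeRing)
open import Function.Bundles using (_↔_; Inverse)

record FiniteField : Set₁ where
  field
    Carrier : Set
    _+_ _*_ : Carrier → Carrier → Carrier
    -_      : Carrier → Carrier
    0# 1#   : Carrier
    isCommutativeRing : IsCommutativeRing _≡_ _+_ _*_ -_ 0# 1#
    _≟_     : (x y : Carrier) → Dec (x ≡ y)
    0≢1     : ¬ (0# ≡ 1#)
    inverse : ∀ x → ¬ (x ≡ 0#) → ∃[ y ] (x * y ≡ 1#)
    elements : List Carrier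
    elements-complete : ∀ x → x ∈ elements
    elements-unique   : Unique elements

  infixl 6 _-_
  _-_ : Carrier → Carrier → Carrier
  x - y = x + (- y)

  order : ℕ
  order = length elements

Mat : Set → Set
Mat X = X → X → ℤ

⟦_⟧ : {P : Set} → Dec P → ℤ
⟦ yes _ ⟧ = 1ℤ
⟦ no  _ ⟧ = 0ℤ

record FinType : Set₁ where
  field
    El    : Set
    _≟_   : (x y : El) → Dec (x ≡ y)
    enum  : List El

FinType-of : FiniteField → FinType
FinType-of F = record { El = Carrier ; _≟_ = _≟_ ; enum = elements }
  where open FiniteField F

_×ᶠ_ : FinType → FinType → FinType
S ×ᶠ T = record
  { El = FinType.El S × FinType.El T
  ; _≟_ = ≡-dec (FinType._≟_ S) (FinType._≟_ T)
  ; enum = cartesianProduct (FinType.enum S) (FinType.enum T) }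

Σ-list : {A : Set} → List A → (A → ℤ) → ℤ
Σ-list xs f = foldr (λ a s → f a +ℤ s) 0ℤ xs

module _ (T : FinType) where
  open FinType T

  Iₘ : Mat El
  Iₘ x y = ⟦ x ≟ y ⟧

  Jₘ : Mat El
  Jₘ _ _ = 1ℤ

_⊗_ : {X Y : Set} → Mat X → Mat Y → Mat (X × Y)
(M ⊗ N) (x , y) (x' , y') = M x x' *ℤ N y y'

_-ₘ_ : {X : Set} → Mat X → Mat X → Mat X
(M -ₘ N) x y = M x y -ℤ N x y

_ᵀ : {X : Set} → Mat X → Mat X
(M ᵀ) x y = M y x

mul : (T : FinType) → Mat (FinType.El T) → Mat (FinType.El T) → Mat (FinType.El T)
mul T M N x y = Σ-list (FinType.enum T) (λ z → M x z *ℤ N z y)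

record IsCommAssocScheme (X : FinType) (Idx : Set) (idxs : List Idx) (i₀ : Idx)
         (A : Idx → Mat (FinType.El X)) (n : ℕ) : Set where
  field
    idxs-complete : ∀ i → i ∈ idxs
    idxs-unique   : Unique idxs
    #classes   : length idxs ≡ suc n
    zero-one   : ∀ i x y → (A i x y ≡ 0ℤ) ⊎ (A i x y ≡ 1ℤ)
    nonzero    : ∀ i → ∃[ x ] ∃[ y ] (¬ (A i x y ≡ 0ℤ))
    A₀≡I       : ∀ x y → A i₀ x y ≡ Iₘ X x y
    sum≡J      : ∀ x y → Σ-list idxs (λ i → A i x y) ≡ Jₘ X x y
    transpose  : ∀ i → ¬ (i ≡ i₀) →
                   ∃[ j ] (¬ (j ≡ i₀) × (∀ x y → (A i ᵀ) x y ≡ A j x y))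
    closed     : ∀ i j → Σ (Idx → ℤ) λ c → (∀ x y →
                   mul X (A i) (A j) x y ≡ Σ-list idxs (λ k → c k *ℤ A k x y))
    commute    : ∀ i j x y → mul X (A i) (A j) x y ≡ mul X (A j) (A i) x y

-- The specific construction.  Maybe 𝔽_q stands for 𝔽_q ∪ {x},
-- with nothing playing the role of the new symbol x.

module Construction (Fq Fq1 : FiniteField)
                    (φ : FiniteField.Carrier Fq1 ↔ Maybe (FiniteField.Carrier Fq)) where
  private
    module F = FiniteField Fq
    module G = FiniteField Fq1
  open Inverse φ renaming (to to φ→)

  TF TG TX : FinType
  TF = FinType-of Fq
  TG = FinType-of Fq1
  TX = TG ×ᶠ (TF ×ᶠ TF)

  Pt : Set
  Pt = FinType.El TX

  N : G.Carrier → Mat Pt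
  N β (b , a₁ , a₂) (b' , a₁' , a₂') with φ→ (β G.* (b' G.- b))
  ... | nothing = 0ℤ
  ... | just c  = ⟦ (a₂' F.- a₂) F.≟ (c F.* (a₁' F.- a₁)) ⟧

  A₀ A₁ A₂ A₃ A₄ : Mat Pt
  A₀ = Iₘ TG ⊗ (Iₘ TF ⊗ Iₘ TF)
  A₁ = Iₘ TG ⊗ (Iₘ TF ⊗ (Jₘ TF -ₘ Iₘ TF))
  A₂ = Iₘ TG ⊗ ((Jₘ TF -ₘ Iₘ TF) ⊗ Jₘ TF)
  A₃ = (Jₘ TG -ₘ Iₘ TG) ⊗ (Iₘ TF ⊗ Iₘ TF)
  A₄ = (Jₘ TG -ₘ Iₘ TG) ⊗ (Iₘ TF ⊗ (Jₘ TF -ₘ Iₘ TF))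

  A₅ : G.Carrier → Mat Pt
  A₅ β = N β -ₘ A₃

  data Cls : Set where
    c0 c1 c2 c3 c4 : Cls
    c5 : (β : G.Carrier) → False (β G.≟ G.0#) → Cls

  nz : G.Carrier → List Cls
  nz β with β G.≟ G.0#
  ... | yes _  = []
  ... | no β≢0 = c5 β (fromWitnessFalse β≢0) ∷ []

  classes : List Cls
  classes = c0 ∷ c1 ∷ c2 ∷ c3 ∷ c4 ∷ concatMap nz G.elements

  A : Cls → Mat Pt
  A c0 = A₀
  A c1 = A₁
  A c2 = A₂
  A c3 = A₃
  A c4 = A₄
  A (c5 β _) = A₅ β

module Submission where

-- Every adjacency matrix depends only on the difference
-- y - x = (d, e₁, e₂) ∈ 𝔽_{q+1} × 𝔽_q × 𝔽_q of its row and column, and A₀, …,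
-- A₄ and Σ_β A_{5,β} depend only on which of d, e₁, e₂ vanish.  Hence all
-- products commute (z ↦ x + y - z exchanges the factors), and a product lies
-- in the span of the classes as soon as its difference form is a function of
-- the vanishing pattern plus integer multiples of single classes A_{5,δ}
-- (closed-by).  Products of A₀, …, A₄ are Kronecker matrices of the same
-- admissible shape, whose coefficients are their values at the six vanishing
-- patterns (corner-expansion).  The products with N_β count points on lines
-- of 𝔽_q²: N_β(x, z) says that z lies on the line through x of slope
-- φ(β (b_z - b_x)).  So N_β · A_k counts the points of one line, and N_β N_γ
-- the common points of two lines through x and y; when β + γ ≠ 0 the slopes
-- agree for exactly one middle coordinate, producing A_{5,δ} with
-- δ = βγ/(β + γ), and when β + γ = 0 they agree exactly when b_x = b_y.

open import Defs
open import Level using (0ℓ)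
open import Data.Nat as ℕ using (ℕ; zero; suc)
import Data.Nat.Properties as ℕP
import Data.Integer as ℤ
open ℤ using (ℤ; -[1+_]; _⊖_)
import Data.Integer.Properties as ℤP
open import Data.Integer.Tactic.RingSolver using (solve-∀)
open import Data.Sign as Sign using (Sign)
open import Data.Bool.Properties using (T-irrelevant)
open import Data.Product using (_×_; _,_; Σ; ∃; ∃-syntax; proj₁; proj₂)
open import Data.Sum using (_⊎_; inj₁; inj₂)
open import Data.Maybe using (Maybe; just; nothing)
import Data.Maybe.Properties as MaybeP
open import Data.List using (List; []; _∷_; length; map; cartesianProduct; concatMap; _++_)
open import Data.List.Membership.Propositional using (_∈_)
open import Data.List.Membership.Propositional.Properties using (∈-map⁺; ∈-++⁺ˡ; ∈-++⁺ʳ)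
open import Data.List.Relation.Unary.Any as Any using (Any; here; there)
open import Data.List.Relation.Unary.All as All using (All; []; _∷_)
import Data.List.Relation.Unary.All.Properties as AllP
open import Data.List.Relation.Unary.Unique.Propositional using (Unique)
import Data.List.Relation.Unary.Unique.Propositional.Properties as UniqueP
open import Data.List.Relation.Unary.AllPairs using ([]; _∷_)
open import Relation.Nullary using (¬_; Dec; yes; no)
open import Relation.Nullary.Decidable using (False; toWitnessFalse; fromWitnessFalse)
open import Relation.Binary.PropositionalEquality using (_≡_; refl; sym; trans; cong; cong₂; subst; module ≡-Reasoning)
open import Function.Bundles using (_↔_; Inverse)
open import Data.Empty using (⊥-elim)
open import Algebra.Bundles using (CommutativeRing)
import Algebra.Solver.Ring.AlmostCommutativeRing as ACR
import Algebra.Solver.Ring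

-- The solver takes integer coefficients, interpreted through the
-- canonical map ℤ → K: the library solver needs a coefficient ring whose
-- equality is decidable by evaluation, so K itself cannot serve.

module Field (K : FiniteField) where
  open FiniteField K public using (Carrier; 0#; 1#; _≟_; 0≢1; inverse; elements; elements-complete; elements-unique; order)
  private module K = FiniteField K

  infixl 6 _+_ _-_
  infixl 7 _*_
  infix 8 -_
  _+_ _*_ _-_ : Carrier → Carrier → Carrier
  _+_ = K._+_
  _*_ = K._*_
  _-_ = K._-_
  -_ : Carrier → Carrier
  -_ = K.-_

  private
    commutativeRing : CommutativeRing 0ℓ 0ℓ
    commutativeRing = record { isCommutativeRing = K.isCommutativeRing }

    open CommutativeRing commutativeRing
      using (ring; semiring; +-identityˡ; +-identityʳ; +-assoc; +-comm; -‿inverseʳ)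
    open import Algebra.Properties.Ring ring using (-0#≈0#; -‿distribˡ-*; -‿distribʳ-*; -‿involutive; -‿+-comm)
    open import Algebra.Properties.Semiring.Mult.TCOptimised semiring using (×-homo-+; ×1-homo-*; 1+×) renaming (_×_ to _·1_)
    open ≡-Reasoning

    ι : ℕ → Carrier
    ι n = n ·1 1#

    emb : ℤ → Carrier
    emb (ℤ.+ n) = ι n
    emb -[1+ n ] = - ι (suc n)

    cancelˡ : ∀ a x y → (a + x) - (a + y) ≡ x - y
    cancelˡ a x y = begin
      (a + x) + - (a + y)   ≡⟨ cong ((a + x) +_) (sym (-‿+-comm a y)) ⟩
      (a + x) + (- a + - y) ≡⟨ +-assoc a x _ ⟩
      a + (x + (- a + - y)) ≡⟨ cong (a +_) (trans (sym (+-assoc x (- a) (- y))) (cong (_+ - y) (+-comm x (- a)))) ⟩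
      a + ((- a + x) + - y) ≡⟨ cong (a +_) (+-assoc (- a) x (- y)) ⟩
      a + (- a + (x + - y)) ≡⟨ sym (+-assoc a (- a) _) ⟩
      (a + - a) + (x + - y) ≡⟨ cong (_+ (x + - y)) (-‿inverseʳ a) ⟩
      0# + (x + - y)        ≡⟨ +-identityˡ _ ⟩
      x + - y               ∎

    ⊖-homo : ∀ m n → emb (m ⊖ n) ≡ ι m - ι n
    ⊖-homo zero zero = trans (sym (+-identityʳ 0#)) (cong (0# +_) (sym -0#≈0#))
    ⊖-homo zero (suc n) = sym (+-identityˡ _)
    ⊖-homo (suc m) zero = trans (sym (+-identityʳ _)) (cong (ι (suc m) +_) (sym -0#≈0#))
    ⊖-homo (suc m) (suc n) = begin
      emb (suc m ⊖ suc n)   ≡⟨ cong emb (ℤP.[1+m]⊖[1+n]≡m⊖n m n) ⟩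
      emb (m ⊖ n)           ≡⟨ ⊖-homo m n ⟩
      ι m - ι n             ≡⟨ sym (cancelˡ 1# (ι m) (ι n)) ⟩
      (1# + ι m) - (1# + ι n) ≡⟨ sym (cong₂ _-_ (1+× m 1#) (1+× n 1#)) ⟩
      ι (suc m) - ι (suc n) ∎

    +-homo : ∀ i j → emb (i ℤ.+ j) ≡ emb i + emb j
    +-homo (ℤ.+ m) (ℤ.+ n) = ×-homo-+ 1# m n
    +-homo (ℤ.+ m) -[1+ n ] = ⊖-homo m (suc n)
    +-homo -[1+ m ] (ℤ.+ n) = trans (⊖-homo n (suc m)) (+-comm _ _)
    +-homo -[1+ m ] -[1+ n ] = begin
      - ι (suc (suc (m ℕ.+ n)))         ≡⟨ cong (λ k → - ι (suc k)) (sym (ℕP.+-suc m n)) ⟩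
      - ι (suc m ℕ.+ suc n)             ≡⟨ cong -_ (×-homo-+ 1# (suc m) (suc n)) ⟩
      - (ι (suc m) + ι (suc n))         ≡⟨ sym (-‿+-comm _ _) ⟩
      - ι (suc m) + - ι (suc n)         ∎

    signed : Sign → Carrier → Carrier
    signed Sign.+ x = x
    signed Sign.- x = - x

    ◃-homo : ∀ s n → emb (s ℤ.◃ n) ≡ signed s (ι n)
    ◃-homo Sign.+ zero = refl
    ◃-homo Sign.- zero = sym -0#≈0#
    ◃-homo Sign.+ (suc n) = refl
    ◃-homo Sign.- (suc n) = refl

    sign-abs : ∀ i → emb i ≡ signed (ℤ.sign i) (ι ℤ.∣ i ∣)
    sign-abs (ℤ.+ n) = refl
    sign-abs -[1+ n ] = refl

    signed-* : ∀ s t x y → signed (s Sign.* t) (x * y) ≡ signed s x * signed t y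
    signed-* Sign.+ Sign.+ x y = refl
    signed-* Sign.+ Sign.- x y = -‿distribʳ-* x y
    signed-* Sign.- Sign.+ x y = -‿distribˡ-* x y
    signed-* Sign.- Sign.- x y = begin
      x * y         ≡⟨ sym (-‿involutive (x * y)) ⟩
      - - (x * y)   ≡⟨ cong -_ (-‿distribʳ-* x y) ⟩
      - (x * - y)   ≡⟨ -‿distribˡ-* x (- y) ⟩
      - x * - y     ∎

    *-homo : ∀ i j → emb (i ℤ.* j) ≡ emb i * emb j
    *-homo i j = begin
      emb (i ℤ.* j)
        ≡⟨ ◃-homo (ℤ.sign i Sign.* ℤ.sign j) (ℤ.∣ i ∣ ℕ.* ℤ.∣ j ∣) ⟩
      signed (ℤ.sign i Sign.* ℤ.sign j) (ι (ℤ.∣ i ∣ ℕ.* ℤ.∣ j ∣))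
        ≡⟨ cong (signed (ℤ.sign i Sign.* ℤ.sign j)) (×1-homo-* ℤ.∣ i ∣ ℤ.∣ j ∣) ⟩
      signed (ℤ.sign i Sign.* ℤ.sign j) (ι ℤ.∣ i ∣ * ι ℤ.∣ j ∣)
        ≡⟨ signed-* (ℤ.sign i) (ℤ.sign j) _ _ ⟩
      signed (ℤ.sign i) (ι ℤ.∣ i ∣) * signed (ℤ.sign j) (ι ℤ.∣ j ∣)
        ≡⟨ sym (cong₂ _*_ (sign-abs i) (sign-abs j)) ⟩
      emb i * emb j ∎

    neg-homo : ∀ i → emb (ℤ.- i) ≡ - emb i
    neg-homo (ℤ.+ zero) = sym -0#≈0#
    neg-homo (ℤ.+ suc n) = refl
    neg-homo -[1+ n ] = sym (-‿involutive _)

    ring⁺ : ACR.AlmostCommutativeRing 0ℓ 0ℓ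
    ring⁺ = ACR.fromCommutativeRing commutativeRing

    homomorphism : ℤ.+-*-rawRing ACR.-Raw-AlmostCommutative⟶ ring⁺
    homomorphism = record
      { ⟦_⟧ = emb ; +-homo = +-homo ; *-homo = *-homo ; -‿homo = neg-homo
      ; 0-homo = refl ; 1-homo = refl }

    coefficients≟ : ∀ (a b : ℤ) → Maybe (emb a ≡ emb b)
    coefficients≟ a b with a ℤ.≟ b
    ... | yes refl = just refl
    ... | no _ = nothing

  open Algebra.Solver.Ring ℤ.+-*-rawRing ring⁺ homomorphism coefficients≟ public
    using (solve; _:+_; _:*_; _:-_; :-_; con; _:=_)

  x-y≡0⇒x≡y : ∀ x y → x - y ≡ 0# → x ≡ y
  x-y≡0⇒x≡y x y e = trans (split x y) (trans (cong (_+ y) e) (0+ y))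
    where
    split : ∀ x y → x ≡ (x - y) + y
    split = solve 2 (λ x y → x := (x :- y) :+ y) refl
    0+ : ∀ y → 0# + y ≡ y
    0+ = solve 1 (λ y → con (ℤ.+ 0) :+ y := y) refl

  x≡y⇒x-y≡0 : ∀ {x y} → x ≡ y → x - y ≡ 0#
  x≡y⇒x-y≡0 {x} refl = solve 1 (λ x → x :- x := con (ℤ.+ 0)) refl x

  *-zeroʳ : ∀ k → k * 0# ≡ 0#
  *-zeroʳ = solve 1 (λ k → k :* con (ℤ.+ 0) := con (ℤ.+ 0)) refl

  *-zeroˡ : ∀ k → 0# * k ≡ 0#
  *-zeroˡ = solve 1 (λ k → con (ℤ.+ 0) :* k := con (ℤ.+ 0)) refl

  -- If X - Y is a multiple of X' - Y', then X' = Y' implies X = Y.  This is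
  -- how equivalences between linear equations are transported.
  ≡-by-multiple : ∀ k {X Y X' Y'} → X - Y ≡ k * (X' - Y') → X' ≡ Y' → X ≡ Y
  ≡-by-multiple k {X} {Y} e e' = x-y≡0⇒x≡y X Y (trans e (trans (cong (k *_) (x≡y⇒x-y≡0 e')) (*-zeroʳ k)))

  NonZero : Carrier → Set
  NonZero x = ¬ (x ≡ 0#)

  _⁻¹ : ∀ k → NonZero k → Carrier
  (k ⁻¹) k≢0 = proj₁ (inverse k k≢0)

  *-inverseʳ : ∀ k (k≢0 : NonZero k) → k * (k ⁻¹) k≢0 ≡ 1#
  *-inverseʳ k k≢0 = proj₂ (inverse k k≢0)

  1≢0 : NonZero 1#
  1≢0 e = 0≢1 (sym e)

  *-cancel-≡0 : ∀ k {z} → NonZero k → k * z ≡ 0# → z ≡ 0#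
  *-cancel-≡0 k {z} k≢0 e =
    begin
      z                            ≡⟨ solve 1 (λ z → z := con (ℤ.+ 1) :* z) refl z ⟩
      1# * z                       ≡⟨ cong (_* z) (sym (*-inverseʳ k k≢0)) ⟩
      (k * (k ⁻¹) k≢0) * z         ≡⟨ solve 3 (λ k i z → (k :* i) :* z := i :* (k :* z)) refl k ((k ⁻¹) k≢0) z ⟩
      (k ⁻¹) k≢0 * (k * z)         ≡⟨ cong ((k ⁻¹) k≢0 *_) e ⟩
      (k ⁻¹) k≢0 * 0#              ≡⟨ *-zeroʳ _ ⟩
      0#                           ∎
    where open ≡-Reasoning

  *-nonZero : ∀ {x y} → NonZero x → NonZero y → NonZero (x * y)
  *-nonZero x≢0 y≢0 e = y≢0 (*-cancel-≡0 _ x≢0 e)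

  ⁻¹-nonZero : ∀ k (k≢0 : NonZero k) → NonZero ((k ⁻¹) k≢0)
  ⁻¹-nonZero k k≢0 e = 0≢1 (trans (sym (*-zeroʳ k)) (trans (cong (k *_) (sym e)) (*-inverseʳ k k≢0)))

  -‿nonZero : ∀ {x} → NonZero x → NonZero (- x)
  -‿nonZero {x} x≢0 e = x≢0 (trans (solve 1 (λ x → x := :- (:- x)) refl x)
                                   (trans (cong -_ e) (solve 0 (:- con (ℤ.+ 0) := con (ℤ.+ 0)) refl)))

  solution : ∀ k → NonZero k → Carrier → Carrier
  solution k k≢0 c = c * (k ⁻¹) k≢0

  solution-correct : ∀ k (k≢0 : NonZero k) c → k * solution k k≢0 c ≡ c
  solution-correct k k≢0 c =
    trans (solve 3 (λ k c i → k :* (c :* i) := c :* (k :* i)) refl k c _)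
          (trans (cong (c *_) (*-inverseʳ k k≢0)) (solve 1 (λ c → c :* con (ℤ.+ 1) := c) refl c))

  solution-unique : ∀ k (k≢0 : NonZero k) {c} z → k * z ≡ c → z ≡ solution k k≢0 c
  solution-unique k k≢0 {c} z e =
    begin
      z                      ≡⟨ solve 1 (λ z → z := z :* con (ℤ.+ 1)) refl z ⟩
      z * 1#                 ≡⟨ cong (z *_) (sym (*-inverseʳ k k≢0)) ⟩
      z * (k * (k ⁻¹) k≢0)   ≡⟨ solve 3 (λ z k i → z :* (k :* i) := (k :* z) :* i) refl z k _ ⟩
      (k * z) * (k ⁻¹) k≢0   ≡⟨ cong (_* (k ⁻¹) k≢0) e ⟩
      solution k k≢0 c       ∎
    where open ≡-Reasoning

  line : Carrier → Carrier → Carrier → Carrier → Carrier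
  line x₁ x₂ c z₁ = x₂ + c * (z₁ - x₁)

  line-correct : ∀ x₁ x₂ c z₁ → line x₁ x₂ c z₁ - x₂ ≡ c * (z₁ - x₁)
  line-correct x₁ x₂ c z₁ = x-y≡0⇒x≡y _ _ (solve 4 (λ x₁ x₂ c z₁ → ((x₂ :+ c :* (z₁ :- x₁)) :- x₂) :- c :* (z₁ :- x₁)
                                                     := con (ℤ.+ 0)) refl x₁ x₂ c z₁)

  line-unique : ∀ x₁ x₂ c z₁ z₂ → z₂ - x₂ ≡ c * (z₁ - x₁) → z₂ ≡ line x₁ x₂ c z₁
  line-unique x₁ x₂ c z₁ z₂ =
    ≡-by-multiple 1# (solve 5 (λ x₁ x₂ c z₁ z₂ → z₂ :- (x₂ :+ c :* (z₁ :- x₁)) := con (ℤ.+ 1) :* ((z₂ :- x₂) :- c :* (z₁ :- x₁)))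
                            refl x₁ x₂ c z₁ z₂)

-- From here on the arithmetic operators are those of ℤ (the field operators
-- are used qualified).
open import Data.Integer using (0ℤ; 1ℤ; _+_; _*_; _-_; -_)

⟦⟧-yes : {P : Set} (d : Dec P) → P → ⟦ d ⟧ ≡ 1ℤ
⟦⟧-yes (yes _) _ = refl
⟦⟧-yes (no ¬p) p = ⊥-elim (¬p p)

⟦⟧-no : {P : Set} (d : Dec P) → ¬ P → ⟦ d ⟧ ≡ 0ℤ
⟦⟧-no (yes p) ¬p = ⊥-elim (¬p p)
⟦⟧-no (no _) _ = refl

⟦⟧-iff : {P Q : Set} (d : Dec P) (e : Dec Q) → (P → Q) → (Q → P) → ⟦ d ⟧ ≡ ⟦ e ⟧
⟦⟧-iff (yes p) (yes q) f g = refl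
⟦⟧-iff (yes p) (no ¬q) f g = ⊥-elim (¬q (f p))
⟦⟧-iff (no ¬p) (yes q) f g = ⊥-elim (¬p (g q))
⟦⟧-iff (no ¬p) (no ¬q) f g = refl

ZeroOne : ℤ → Set
ZeroOne z = (z ≡ 0ℤ) ⊎ (z ≡ 1ℤ)

zeroOne-⟦⟧ : {P : Set} (d : Dec P) → ZeroOne ⟦ d ⟧
zeroOne-⟦⟧ (yes _) = inj₂ refl
zeroOne-⟦⟧ (no _) = inj₁ refl

zeroOne-* : ∀ {a b} → ZeroOne a → ZeroOne b → ZeroOne (a * b)
zeroOne-* (inj₁ refl) _ = inj₁ refl
zeroOne-* (inj₂ refl) (inj₁ refl) = inj₁ refl
zeroOne-* (inj₂ refl) (inj₂ refl) = inj₂ refl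

zeroOne-1- : ∀ {a} → ZeroOne a → ZeroOne (1ℤ - a)
zeroOne-1- (inj₁ refl) = inj₂ refl
zeroOne-1- (inj₂ refl) = inj₁ refl

module _ {A : Set} where

  Σ-cong : ∀ (xs : List A) {f g : A → ℤ} → (∀ a → f a ≡ g a) → Σ-list xs f ≡ Σ-list xs g
  Σ-cong [] e = refl
  Σ-cong (x ∷ xs) e = cong₂ _+_ (e x) (Σ-cong xs e)

  Σ-+ : ∀ (xs : List A) (f g : A → ℤ) → Σ-list xs (λ a → f a + g a) ≡ Σ-list xs f + Σ-list xs g
  Σ-+ [] f g = refl
  Σ-+ (x ∷ xs) f g = trans (cong (f x + g x +_) (Σ-+ xs f g)) (swap (f x) (g x) _ _)
    where
    swap : ∀ a b c d → a + b + (c + d) ≡ a + c + (b + d)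
    swap = solve-∀

  Σ-- : ∀ (xs : List A) (f g : A → ℤ) → Σ-list xs (λ a → f a - g a) ≡ Σ-list xs f - Σ-list xs g
  Σ-- [] f g = refl
  Σ-- (x ∷ xs) f g = trans (cong (f x - g x +_) (Σ-- xs f g)) (swap (f x) (g x) _ _)
    where
    swap : ∀ a b c d → a - b + (c - d) ≡ a + c - (b + d)
    swap = solve-∀

  Σ-*ˡ : ∀ (xs : List A) (c : ℤ) (f : A → ℤ) → Σ-list xs (λ a → c * f a) ≡ c * Σ-list xs f
  Σ-*ˡ [] c f = sym (ℤP.*-zeroʳ c)
  Σ-*ˡ (x ∷ xs) c f = trans (cong (c * f x +_) (Σ-*ˡ xs c f)) (sym (ℤP.*-distribˡ-+ c (f x) _))

  Σ-*ʳ : ∀ (xs : List A) (c : ℤ) (f : A → ℤ) → Σ-list xs (λ a → f a * c) ≡ Σ-list xs f * c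
  Σ-*ʳ xs c f = trans (Σ-cong xs (λ a → ℤP.*-comm (f a) c)) (trans (Σ-*ˡ xs c f) (ℤP.*-comm c _))

  Σ-zero : ∀ (xs : List A) {f : A → ℤ} → All (λ a → f a ≡ 0ℤ) xs → Σ-list xs f ≡ 0ℤ
  Σ-zero [] [] = refl
  Σ-zero (x ∷ xs) (p ∷ ps) = cong₂ _+_ p (Σ-zero xs ps)

  Σ-const : ∀ (xs : List A) (c : ℤ) → Σ-list xs (λ _ → c) ≡ ℤ.+ length xs * c
  Σ-const [] c = refl
  Σ-const (x ∷ xs) c = trans (cong (c +_) (Σ-const xs c)) (step (ℤ.+ length xs) c)
    where
    step : ∀ n c → c + n * c ≡ (1ℤ + n) * c
    step = solve-∀

  Σ-++ : ∀ (xs ys : List A) (f : A → ℤ) → Σ-list (xs ++ ys) f ≡ Σ-list xs f + Σ-list ys f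
  Σ-++ [] ys f = sym (ℤP.+-identityˡ _)
  Σ-++ (x ∷ xs) ys f = trans (cong (f x +_) (Σ-++ xs ys f)) (sym (ℤP.+-assoc (f x) _ _))

  Σ-select : ∀ (xs : List A) → Unique xs → ∀ {t} → t ∈ xs →
             {P : A → Set} (P? : ∀ a → Dec (P a)) → (∀ a → P a → a ≡ t) → P t →
             (h : A → ℤ) → Σ-list xs (λ a → ⟦ P? a ⟧ * h a) ≡ h t
  Σ-select (x ∷ xs) (x∉xs ∷ _) (here refl) P? only pt h =
    begin
      ⟦ P? x ⟧ * h x + Σ-list xs (λ a → ⟦ P? a ⟧ * h a)
    ≡⟨ cong₂ _+_ (cong (_* h x) (⟦⟧-yes (P? x) pt)) (Σ-zero xs (All.map vanish x∉xs)) ⟩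
      1ℤ * h x + 0ℤ
    ≡⟨ trans (ℤP.+-identityʳ _) (ℤP.*-identityˡ (h x)) ⟩
      h x
    ∎
    where
    open ≡-Reasoning
    vanish : ∀ {a} → ¬ x ≡ a → ⟦ P? a ⟧ * h a ≡ 0ℤ
    vanish x≢a = cong (_* h _) (⟦⟧-no (P? _) (λ pa → x≢a (sym (only _ pa))))
  Σ-select (x ∷ xs) (x∉xs ∷ u) (there t∈xs) P? only pt h =
    trans (cong₂ _+_ (cong (_* h x) (⟦⟧-no (P? x) (λ px → All.lookup x∉xs t∈xs (only x px))))
                     (Σ-select xs u t∈xs P? only pt h))
          (ℤP.+-identityˡ (h _))

  Σ-map : ∀ {B : Set} (g : B → A) (xs : List B) (f : A → ℤ) → Σ-list (map g xs) f ≡ Σ-list xs (λ b → f (g b))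
  Σ-map g [] f = refl
  Σ-map g (x ∷ xs) f = cong (f (g x) +_) (Σ-map g xs f)

module _ {A B : Set} where

  Σ-swap : ∀ (xs : List A) (ys : List B) (f : A → B → ℤ) →
           Σ-list xs (λ a → Σ-list ys (f a)) ≡ Σ-list ys (λ b → Σ-list xs (λ a → f a b))
  Σ-swap [] ys f = sym (Σ-zero ys (All.universal (λ _ → refl) ys))
  Σ-swap (x ∷ xs) ys f = trans (cong (Σ-list ys (f x) +_) (Σ-swap xs ys f))
                               (sym (Σ-+ ys (f x) (λ b → Σ-list xs (λ a → f a b))))

  Σ-cart : ∀ (xs : List A) (ys : List B) (f : A × B → ℤ) →
           Σ-list (cartesianProduct xs ys) f ≡ Σ-list xs (λ a → Σ-list ys (λ b → f (a , b)))
  Σ-cart [] ys f = refl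
  Σ-cart (x ∷ xs) ys f = trans (Σ-++ (map (x ,_) ys) (cartesianProduct xs ys) f)
                               (cong₂ _+_ (Σ-map (x ,_) ys f) (Σ-cart xs ys f))

  Σ-reindex : ∀ (xs : List A) → Unique xs → (∀ a → a ∈ xs) →
              (ys : List B) → Unique ys → (∀ b → b ∈ ys) → (_≟B_ : (b b' : B) → Dec (b ≡ b')) →
              (g : A → B) (g⁻¹ : B → A) → (∀ b → g (g⁻¹ b) ≡ b) → (∀ a → g⁻¹ (g a) ≡ a) →
              (f : B → ℤ) → Σ-list xs (λ a → f (g a)) ≡ Σ-list ys f
  Σ-reindex xs ux cx ys uy cy _≟B_ g g⁻¹ gg⁻¹ g⁻¹g f =
    begin
      Σ-list xs (λ a → f (g a))
    ≡⟨ Σ-cong xs (λ a → sym (Σ-select ys uy (cy (g a)) (g a ≟B_) (λ b e → sym e) refl f)) ⟩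
      Σ-list xs (λ a → Σ-list ys (λ b → ⟦ g a ≟B b ⟧ * f b))
    ≡⟨ Σ-swap xs ys (λ a b → ⟦ g a ≟B b ⟧ * f b) ⟩
      Σ-list ys (λ b → Σ-list xs (λ a → ⟦ g a ≟B b ⟧ * f b))
    ≡⟨ Σ-cong ys (λ b → Σ-select xs ux (cx (g⁻¹ b)) (λ a → g a ≟B b)
                          (λ a e → trans (sym (g⁻¹g a)) (cong g⁻¹ e)) (gg⁻¹ b) (λ _ → f b)) ⟩
      Σ-list ys f
    ∎
    where open ≡-Reasoning

module _ (T : FinType) where
  open FinType T

  mul-cong : ∀ {M M' N N' : Mat El} → (∀ x y → M x y ≡ M' x y) → (∀ x y → N x y ≡ N' x y) →
             ∀ x y → mul T M N x y ≡ mul T M' N' x y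
  mul-cong eM eN x y = Σ-cong enum (λ z → cong₂ _*_ (eM x z) (eN z y))

  mul-distribʳ-- : ∀ (M M' N : Mat El) x y → mul T (M -ₘ M') N x y ≡ mul T M N x y - mul T M' N x y
  mul-distribʳ-- M M' N x y =
    trans (Σ-cong enum (λ z → distrib (M x z) (M' x z) (N z y))) (Σ-- enum (λ z → M x z * N z y) (λ z → M' x z * N z y))
    where
    distrib : ∀ a b c → (a - b) * c ≡ a * c - b * c
    distrib = solve-∀

  mul-distribˡ-- : ∀ (M N N' : Mat El) x y → mul T M (N -ₘ N') x y ≡ mul T M N x y - mul T M N' x y
  mul-distribˡ-- M N N' x y =
    trans (Σ-cong enum (λ z → distrib (M x z) (N z y) (N' z y))) (Σ-- enum (λ z → M x z * N z y) (λ z → M x z * N' z y))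
    where
    distrib : ∀ a b c → a * (b - c) ≡ a * b - a * c
    distrib = solve-∀

  IJ : ℤ → ℤ → Mat El
  IJ α β x y = α * ⟦ x ≟ y ⟧ + β

  IJ-mul : Unique enum → (∀ a → a ∈ enum) → ∀ α β α' β' x y →
           mul T (IJ α β) (IJ α' β') x y ≡ IJ (α * α') (α * β' + β * α' + ℤ.+ length enum * β * β') x y
  IJ-mul u c α β α' β' x y =
    begin
      Σ-list enum (λ z → (α * ⟦ x ≟ z ⟧ + β) * (α' * ⟦ z ≟ y ⟧ + β'))
    ≡⟨ Σ-cong enum (λ z → expand α β α' β' ⟦ x ≟ z ⟧ ⟦ z ≟ y ⟧) ⟩
      Σ-list enum (λ z → ⟦ x ≟ z ⟧ * (α * (α' * ⟦ z ≟ y ⟧ + β')) + ⟦ z ≟ y ⟧ * (β * α') + β * β')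
    ≡⟨ trans (Σ-+ enum (λ z → P z + Q z) (λ _ → β * β')) (cong₂ _+_ (Σ-+ enum P Q) (Σ-const enum (β * β'))) ⟩
      Σ-list enum (λ z → ⟦ x ≟ z ⟧ * (α * (α' * ⟦ z ≟ y ⟧ + β'))) + Σ-list enum (λ z → ⟦ z ≟ y ⟧ * (β * α'))
        + ℤ.+ length enum * (β * β')
    ≡⟨ cong (_+ ℤ.+ length enum * (β * β'))
         (cong₂ _+_ (Σ-select enum u (c x) (x ≟_) (λ z e → sym e) refl (λ z → α * (α' * ⟦ z ≟ y ⟧ + β')))
                    (Σ-select enum u (c y) (_≟ y) (λ z e → e) refl (λ _ → β * α'))) ⟩
      α * (α' * ⟦ x ≟ y ⟧ + β') + β * α' + ℤ.+ length enum * (β * β')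
    ≡⟨ collect α β α' β' (ℤ.+ length enum) ⟦ x ≟ y ⟧ ⟩
      α * α' * ⟦ x ≟ y ⟧ + (α * β' + β * α' + ℤ.+ length enum * β * β')
    ∎
    where
    open ≡-Reasoning
    P Q : El → ℤ
    P z = ⟦ x ≟ z ⟧ * (α * (α' * ⟦ z ≟ y ⟧ + β'))
    Q z = ⟦ z ≟ y ⟧ * (β * α')
    expand : ∀ α β α' β' e f → (α * e + β) * (α' * f + β') ≡ e * (α * (α' * f + β')) + f * (β * α') + β * β'
    expand = solve-∀
    collect : ∀ α β α' β' n e → α * (α' * e + β') + β * α' + n * (β * β') ≡ α * α' * e + (α * β' + β * α' + n * β * β')
    collect = solve-∀

kron-mul : ∀ (S T : FinType) (M M' : Mat (FinType.El S)) (N N' : Mat (FinType.El T)) x y x' y' →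
  mul (S ×ᶠ T) (M ⊗ N) (M' ⊗ N') (x , y) (x' , y') ≡ mul S M M' x x' * mul T N N' y y'
kron-mul S T M M' N N' x y x' y' =
  begin
    Σ-list (cartesianProduct (FinType.enum S) (FinType.enum T)) (λ z → (M ⊗ N) (x , y) z * (M' ⊗ N') z (x' , y'))
  ≡⟨ Σ-cart (FinType.enum S) (FinType.enum T) (λ z → (M ⊗ N) (x , y) z * (M' ⊗ N') z (x' , y')) ⟩
    Σ-list (FinType.enum S) (λ a → Σ-list (FinType.enum T) (λ b → (M x a * N y b) * (M' a x' * N' b y')))
  ≡⟨ Σ-cong (FinType.enum S) (λ a → trans (Σ-cong (FinType.enum T) (λ b → interchange (M x a) (N y b) (M' a x') (N' b y')))
                                           (Σ-*ˡ (FinType.enum T) (M x a * M' a x') (λ b → N y b * N' b y'))) ⟩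
    Σ-list (FinType.enum S) (λ a → (M x a * M' a x') * mul T N N' y y')
  ≡⟨ Σ-*ʳ (FinType.enum S) (mul T N N' y y') (λ a → M x a * M' a x') ⟩
    mul S M M' x x' * mul T N N' y y'
  ∎
  where
  open ≡-Reasoning
  interchange : ∀ a b c d → (a * b) * (c * d) ≡ (a * c) * (b * d)
  interchange = solve-∀

module FieldSums (K : FiniteField) where
  open Field K using (Carrier; 0#; _≟_; elements; elements-complete; elements-unique; order; NonZero;
                     solution; solution-correct; solution-unique; *-zeroʳ; solve; _:+_; _:*_; _:-_; _:=_)
  private module K = Field K

  Σ-elements-const : ∀ c → Σ-list elements (λ _ → c) ≡ ℤ.+ order * c
  Σ-elements-const = Σ-const elements

  Σ-elements-select : ∀ t {P : Carrier → Set} (P? : ∀ a → Dec (P a)) → (∀ a → P a → a ≡ t) → P t →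
                      (h : Carrier → ℤ) → Σ-list elements (λ a → ⟦ P? a ⟧ * h a) ≡ h t
  Σ-elements-select t = Σ-select elements elements-unique (elements-complete t)

  Σ-elements-count : ∀ t {P : Carrier → Set} (P? : ∀ a → Dec (P a)) → (∀ a → P a → a ≡ t) → P t →
                     Σ-list elements (λ a → ⟦ P? a ⟧) ≡ 1ℤ
  Σ-elements-count t P? only pt =
    trans (Σ-cong elements (λ a → sym (ℤP.*-identityʳ ⟦ P? a ⟧))) (Σ-elements-select t P? only pt (λ _ → 1ℤ))

  Σ-elements-affine : ∀ k t → NonZero k → (f : Carrier → ℤ) →
                      Σ-list elements (λ u → f (k K.* (u K.- t))) ≡ Σ-list elements f
  Σ-elements-affine k t k≢0 f =
    Σ-reindex elements elements-unique elements-complete elements elements-unique elements-complete _≟_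
              (λ u → k K.* (u K.- t)) (λ w → t K.+ solution k k≢0 w) forth back f
    where
    forth : ∀ w → k K.* ((t K.+ solution k k≢0 w) K.- t) ≡ w
    forth w = trans (cong (k K.*_) (solve 2 (λ t s → (t :+ s) :- t := s) refl t _)) (solution-correct k k≢0 w)
    back : ∀ u → t K.+ solution k k≢0 (k K.* (u K.- t)) ≡ u
    back u = trans (cong (t K.+_) (sym (solution-unique k k≢0 (u K.- t) refl)))
                   (solve 2 (λ t u → t :+ (u :- t) := u) refl t u)

  Σ-elements-reflect : ∀ s (f : Carrier → ℤ) → Σ-list elements (λ u → f (s K.- u)) ≡ Σ-list elements f
  Σ-elements-reflect s f =
    Σ-reindex elements elements-unique elements-complete elements elements-unique elements-complete _≟_
              (λ u → s K.- u) (λ u → s K.- u) (invol s) (invol s) f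
    where
    invol : ∀ s u → s K.- (s K.- u) ≡ u
    invol = solve 2 (λ s u → s :- (s :- u) := u) refl

  -- the number of slopes s with e₂ = s e₁: one if e₁ ≠ 0, and q or 0 if e₁ = 0
  Σ-slopes : ∀ e₁ e₂ → Σ-list elements (λ s → ⟦ e₂ ≟ (s K.* e₁) ⟧)
                       ≡ 1ℤ - ⟦ e₁ ≟ 0# ⟧ + ℤ.+ order * (⟦ e₁ ≟ 0# ⟧ * ⟦ e₂ ≟ 0# ⟧)
  Σ-slopes e₁ e₂ with e₁ ≟ 0#
  ... | yes refl =
    begin
      Σ-list elements (λ s → ⟦ e₂ ≟ (s K.* 0#) ⟧)
    ≡⟨ Σ-cong elements (λ s → ⟦⟧-iff (e₂ ≟ (s K.* 0#)) (e₂ ≟ 0#) (λ e → trans e (*-zeroʳ s)) (λ e → trans e (sym (*-zeroʳ s)))) ⟩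
      Σ-list elements (λ _ → ⟦ e₂ ≟ 0# ⟧)
    ≡⟨ Σ-elements-const ⟦ e₂ ≟ 0# ⟧ ⟩
      ℤ.+ order * ⟦ e₂ ≟ 0# ⟧
    ≡⟨ rearrange (ℤ.+ order) ⟦ e₂ ≟ 0# ⟧ ⟩
      1ℤ - 1ℤ + ℤ.+ order * (1ℤ * ⟦ e₂ ≟ 0# ⟧)
    ∎
    where
    open ≡-Reasoning
    rearrange : ∀ q e → q * e ≡ 1ℤ - 1ℤ + q * (1ℤ * e)
    rearrange = solve-∀
  ... | no e₁≢0 =
    trans (Σ-elements-count (solution e₁ e₁≢0 e₂) (λ s → e₂ ≟ (s K.* e₁)) only correct)
          (rearrange (ℤ.+ order) ⟦ e₂ ≟ 0# ⟧)
    where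
    only : ∀ s → e₂ ≡ s K.* e₁ → s ≡ solution e₁ e₁≢0 e₂
    only s e = solution-unique e₁ e₁≢0 s (trans (solve 2 (λ a b → a :* b := b :* a) refl e₁ s) (sym e))
    correct : e₂ ≡ solution e₁ e₁≢0 e₂ K.* e₁
    correct = sym (trans (solve 2 (λ a b → a :* b := b :* a) refl _ e₁) (solution-correct e₁ e₁≢0 e₂))
    rearrange : ∀ q e → 1ℤ ≡ 1ℤ - 0ℤ + q * (0ℤ * e)
    rearrange = solve-∀

  Σ-Maybe : ∀ {A : Set} (xs : List A) → Unique xs → (∀ a → a ∈ xs) →
            (ψ : A → Maybe Carrier) (ψ⁻¹ : Maybe Carrier → A) → (∀ m → ψ (ψ⁻¹ m) ≡ m) → (∀ a → ψ⁻¹ (ψ a) ≡ a) →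
            (f : Maybe Carrier → ℤ) → Σ-list xs (λ a → f (ψ a)) ≡ f nothing + Σ-list elements (λ s → f (just s))
  Σ-Maybe xs ux cx ψ ψ⁻¹ ψψ⁻¹ ψ⁻¹ψ f =
    trans (Σ-reindex xs ux cx (nothing ∷ map just elements) unique complete (MaybeP.≡-dec _≟_) ψ ψ⁻¹ ψψ⁻¹ ψ⁻¹ψ f)
          (cong (f nothing +_) (Σ-map just elements f))
    where
    unique : Unique (nothing ∷ map just elements)
    unique = AllP.map⁺ (All.universal (λ _ ()) elements) ∷ UniqueP.map⁺ (λ { refl → refl }) elements-unique
    complete : ∀ m → m ∈ nothing ∷ map just elements
    complete nothing = here refl
    complete (just x) = there (∈-map⁺ just (elements-complete x))

module Scheme (Fq Fq1 : FiniteField)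
  (order-Fq1 : FiniteField.order Fq1 ≡ suc (FiniteField.order Fq))
  (φ : FiniteField.Carrier Fq1 ↔ Maybe (FiniteField.Carrier Fq))
  (φ-0 : Inverse.to φ (FiniteField.0# Fq1) ≡ nothing) where

  open Construction Fq Fq1 φ
  module F = Field Fq
  module G = Field Fq1
  module ΣF = FieldSums Fq
  module ΣG = FieldSums Fq1

  q g : ℤ
  q = ℤ.+ F.order
  g = ℤ.+ G.order

  g≡1+q : g ≡ 1ℤ + q
  g≡1+q = cong ℤ.+_ order-Fq1

  φ→ : G.Carrier → Maybe F.Carrier
  φ→ = Inverse.to φ

  φ-injective : ∀ {u v} → φ→ u ≡ φ→ v → u ≡ v
  φ-injective {u} {v} e =
    trans (sym (Inverse.strictlyInverseʳ φ u)) (trans (cong (Inverse.from φ) e) (Inverse.strictlyInverseʳ φ v))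

  φ-at-0 : ∀ {w} → w ≡ G.0# → φ→ w ≡ nothing
  φ-at-0 refl = φ-0

  finite : Maybe F.Carrier → ℤ
  finite nothing = 0ℤ
  finite (just _) = 1ℤ

  nonZero-of : ∀ β → False (β G.≟ G.0#) → G.NonZero β
  nonZero-of β = toWitnessFalse

  δG : G.Carrier → ℤ
  δG d = ⟦ d G.≟ G.0# ⟧

  δF : F.Carrier → ℤ
  δF e = ⟦ e F.≟ F.0# ⟧

  finite-φ : ∀ β w → G.NonZero β → finite (φ→ (β G.* w)) ≡ 1ℤ - δG w
  finite-φ β w β≢0 with w G.≟ G.0#
  ... | yes refl = cong finite (φ-at-0 (G.*-zeroʳ β))
  ... | no w≢0 with φ→ (β G.* w) in eq
  ...   | nothing = ⊥-elim (G.*-nonZero β≢0 w≢0 (φ-injective (trans eq (sym φ-0))))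
  ...   | just _ = refl

  Diff : Set
  Diff = G.Carrier × F.Carrier × F.Carrier

  diff : Pt → Pt → Diff
  diff (b , a₁ , a₂) (b' , a₁' , a₂') = (b' G.- b , a₁' F.- a₁ , a₂' F.- a₂)

  δG-diff : ∀ b b' → ⟦ b G.≟ b' ⟧ ≡ δG (b' G.- b)
  δG-diff b b' = ⟦⟧-iff (b G.≟ b') ((b' G.- b) G.≟ G.0#) (λ e → G.x≡y⇒x-y≡0 (sym e)) (λ e → sym (G.x-y≡0⇒x≡y b' b e))

  δF-diff : ∀ a a' → ⟦ a F.≟ a' ⟧ ≡ δF (a' F.- a)
  δF-diff a a' = ⟦⟧-iff (a F.≟ a') ((a' F.- a) F.≟ F.0#) (λ e → F.x≡y⇒x-y≡0 (sym e)) (λ e → sym (F.x-y≡0⇒x≡y a' a e))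

  slopeIncidence : Maybe F.Carrier → F.Carrier → F.Carrier → ℤ
  slopeIncidence nothing e₁ e₂ = 0ℤ
  slopeIncidence (just c) e₁ e₂ = ⟦ e₂ F.≟ (c F.* e₁) ⟧

  N-diff : ∀ β b a₁ a₂ b' a₁' a₂' →
           N β (b , a₁ , a₂) (b' , a₁' , a₂') ≡ slopeIncidence (φ→ (β G.* (b' G.- b))) (a₁' F.- a₁) (a₂' F.- a₂)
  N-diff β b a₁ a₂ b' a₁' a₂' with φ→ (β G.* (b' G.- b))
  ... | nothing = refl
  ... | just c = refl

  Ñ : G.Carrier → Diff → ℤ
  Ñ β (d , e₁ , e₂) = slopeIncidence (φ→ (β G.* d)) e₁ e₂

  Ã₃ : Diff → ℤ
  Ã₃ (d , e₁ , e₂) = (1ℤ - δG d) * (δF e₁ * δF e₂)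

  Ã : Cls → Diff → ℤ
  Ã c0 (d , e₁ , e₂) = δG d * (δF e₁ * δF e₂)
  Ã c1 (d , e₁ , e₂) = δG d * (δF e₁ * (1ℤ - δF e₂))
  Ã c2 (d , e₁ , e₂) = δG d * ((1ℤ - δF e₁) * 1ℤ)
  Ã c3 u = Ã₃ u
  Ã c4 (d , e₁ , e₂) = (1ℤ - δG d) * (δF e₁ * (1ℤ - δF e₂))
  Ã (c5 β _) u = Ñ β u - Ã₃ u

  A-diff : ∀ k x y → A k x y ≡ Ã k (diff x y)
  A-diff c0 (b , a₁ , a₂) (b' , a₁' , a₂') rewrite δG-diff b b' | δF-diff a₁ a₁' | δF-diff a₂ a₂' = refl
  A-diff c1 (b , a₁ , a₂) (b' , a₁' , a₂') rewrite δG-diff b b' | δF-diff a₁ a₁' | δF-diff a₂ a₂' = refl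
  A-diff c2 (b , a₁ , a₂) (b' , a₁' , a₂') rewrite δG-diff b b' | δF-diff a₁ a₁' = refl
  A-diff c3 (b , a₁ , a₂) (b' , a₁' , a₂') rewrite δG-diff b b' | δF-diff a₁ a₁' | δF-diff a₂ a₂' = refl
  A-diff c4 (b , a₁ , a₂) (b' , a₁' , a₂') rewrite δG-diff b b' | δF-diff a₁ a₁' | δF-diff a₂ a₂' = refl
  A-diff (c5 β _) (b , a₁ , a₂) (b' , a₁' , a₂')
    rewrite δG-diff b b' | δF-diff a₁ a₁' | δF-diff a₂ a₂' | N-diff β b a₁ a₂ b' a₁' a₂' = refl

  -- Commutativity: matrices that are functions of the difference commute,
  -- because z ↦ x + y - z exchanges the roles of x and y in the product.

  DifferenceMatrix : Mat Pt → Set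
  DifferenceMatrix M = ∀ x y x' y' → diff x y ≡ diff x' y' → M x y ≡ M x' y'

  A-difference : ∀ k → DifferenceMatrix (A k)
  A-difference k x y x' y' e = trans (A-diff k x y) (trans (cong (Ã k) e) (sym (A-diff k x' y')))

  N-difference : ∀ β → DifferenceMatrix (N β)
  N-difference β (b , a₁ , a₂) (b' , a₁' , a₂') (c , d₁ , d₂) (c' , d₁' , d₂') e =
    trans (N-diff β b a₁ a₂ b' a₁' a₂') (trans (cong (Ñ β) e) (sym (N-diff β c d₁ d₂ c' d₁' d₂')))

  ΣPt : (Pt → ℤ) → ℤ
  ΣPt f = Σ-list G.elements (λ b → Σ-list F.elements (λ a₁ → Σ-list F.elements (λ a₂ → f (b , a₁ , a₂))))

  mul-ΣPt : ∀ M M' x y → mul TX M M' x y ≡ ΣPt (λ z → M x z * M' z y)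
  mul-ΣPt M M' x y =
    trans (Σ-cart G.elements (cartesianProduct F.elements F.elements) (λ z → M x z * M' z y))
          (Σ-cong G.elements (λ b → Σ-cart F.elements F.elements (λ a → M x (b , a) * M' (b , a) y)))

  ΣPt-reflect : ∀ s₁ s₂ s₃ (f : Pt → ℤ) → ΣPt (λ { (b , a₁ , a₂) → f (s₁ G.- b , s₂ F.- a₁ , s₃ F.- a₂) }) ≡ ΣPt f
  ΣPt-reflect s₁ s₂ s₃ f =
    trans (Σ-cong G.elements (λ b → trans (Σ-cong F.elements (λ a₁ → ΣF.Σ-elements-reflect s₃ (λ a₂ → f (s₁ G.- b , s₂ F.- a₁ , a₂))))
                                          (ΣF.Σ-elements-reflect s₂ (λ a₁ → Σ-list F.elements (λ a₂ → f (s₁ G.- b , a₁ , a₂))))))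
          (ΣG.Σ-elements-reflect s₁ (λ b → Σ-list F.elements (λ a₁ → Σ-list F.elements (λ a₂ → f (b , a₁ , a₂)))))

  difference-commute : ∀ M M' → DifferenceMatrix M → DifferenceMatrix M' → ∀ x y → mul TX M M' x y ≡ mul TX M' M x y
  difference-commute M M' dM dM' x@(b , a₁ , a₂) y@(b' , a₁' , a₂') =
    begin
      mul TX M M' x y
    ≡⟨ mul-ΣPt M M' x y ⟩
      ΣPt (λ z → M x z * M' z y)
    ≡⟨ sym (ΣPt-reflect (b G.+ b') (a₁ F.+ a₁') (a₂ F.+ a₂') (λ z → M x z * M' z y)) ⟩
      ΣPt (λ z → M x (σ z) * M' (σ z) y)
    ≡⟨ Σ-cong G.elements (λ c → Σ-cong F.elements (λ d₁ → Σ-cong F.elements (λ d₂ → exchange (c , d₁ , d₂)))) ⟩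
      ΣPt (λ z → M' x z * M z y)
    ≡⟨ sym (mul-ΣPt M' M x y) ⟩
      mul TX M' M x y
    ∎
    where
    open ≡-Reasoning
    σ : Pt → Pt
    σ (c , d₁ , d₂) = ((b G.+ b') G.- c , (a₁ F.+ a₁') F.- d₁ , (a₂ F.+ a₂') F.- d₂)
    reflG₁ : ∀ u v w → ((u G.+ v) G.- w) G.- u ≡ v G.- w
    reflG₁ = G.solve 3 (λ u v w → ((u G.:+ v) G.:- w) G.:- u G.:= v G.:- w) refl
    reflG₂ : ∀ u v w → v G.- ((u G.+ v) G.- w) ≡ w G.- u
    reflG₂ = G.solve 3 (λ u v w → v G.:- ((u G.:+ v) G.:- w) G.:= w G.:- u) refl
    reflF₁ : ∀ u v w → ((u F.+ v) F.- w) F.- u ≡ v F.- w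
    reflF₁ = F.solve 3 (λ u v w → ((u F.:+ v) F.:- w) F.:- u F.:= v F.:- w) refl
    reflF₂ : ∀ u v w → v F.- ((u F.+ v) F.- w) ≡ w F.- u
    reflF₂ = F.solve 3 (λ u v w → v F.:- ((u F.:+ v) F.:- w) F.:= w F.:- u) refl
    exchange : ∀ z → M x (σ z) * M' (σ z) y ≡ M' x z * M z y
    exchange z@(c , d₁ , d₂) =
      trans (cong₂ _*_ (dM x (σ z) z y (cong₂ _,_ (reflG₁ b b' c) (cong₂ _,_ (reflF₁ a₁ a₁' d₁) (reflF₁ a₂ a₂' d₂))))
                       (dM' (σ z) y x z (cong₂ _,_ (reflG₂ b b' c) (cong₂ _,_ (reflF₂ a₁ a₁' d₁) (reflF₂ a₂ a₂' d₂)))))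
            (ℤP.*-comm (M z y) (M' x z))

  commute : ∀ i j x y → mul TX (A i) (A j) x y ≡ mul TX (A j) (A i) x y
  commute i j = difference-commute (A i) (A j) (A-difference i) (A-difference j)

  -- w ↦ φ(k (w - t)) is a bijection 𝔽_{q+1} → 𝔽_q ∪ {∞} for k ≠ 0
  Σ-slopes-affine : ∀ k t → G.NonZero k → (f : Maybe F.Carrier → ℤ) →
    Σ-list G.elements (λ w → f (φ→ (k G.* (w G.- t)))) ≡ f nothing + Σ-list F.elements (λ s → f (just s))
  Σ-slopes-affine k t k≢0 f =
    trans (ΣG.Σ-elements-affine k t k≢0 (λ w → f (φ→ w)))
          (ΣF.Σ-Maybe G.elements G.elements-unique G.elements-complete φ→ (Inverse.from φ)
                      (Inverse.strictlyInverseˡ φ) (Inverse.strictlyInverseʳ φ) f)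

  -- the number of lines through a point in the plane 𝔽_q²: the incidences of
  -- a difference (e₁, e₂) with all finite slopes
  lineCount : F.Carrier → F.Carrier → ℤ
  lineCount e₁ e₂ = 1ℤ - δF e₁ + q * (δF e₁ * δF e₂)

  Σ-Ñ : ∀ d e₁ e₂ → Σ-list G.elements (λ β → Ñ β (d , e₁ , e₂)) ≡ (1ℤ - δG d) * lineCount e₁ e₂
  Σ-Ñ d e₁ e₂ with d G.≟ G.0#
  ... | yes refl =
    trans (Σ-zero G.elements (All.universal (λ β → cong (λ m → slopeIncidence m e₁ e₂) (φ-at-0 (G.*-zeroʳ β))) G.elements))
          (sym (ℤP.*-zeroˡ (lineCount e₁ e₂)))
  ... | no d≢0 =
    begin
      Σ-list G.elements (λ β → slopeIncidence (φ→ (β G.* d)) e₁ e₂)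
    ≡⟨ Σ-cong G.elements (λ β → cong (λ w → slopeIncidence (φ→ w) e₁ e₂) (swap β d)) ⟩
      Σ-list G.elements (λ β → slopeIncidence (φ→ (d G.* (β G.- G.0#))) e₁ e₂)
    ≡⟨ Σ-slopes-affine d G.0# d≢0 (λ m → slopeIncidence m e₁ e₂) ⟩
      0ℤ + Σ-list F.elements (λ s → ⟦ e₂ F.≟ (s F.* e₁) ⟧)
    ≡⟨ trans (ℤP.+-identityˡ _) (ΣF.Σ-slopes e₁ e₂) ⟩
      lineCount e₁ e₂
    ≡⟨ sym (ℤP.*-identityˡ _) ⟩
      (1ℤ - 0ℤ) * lineCount e₁ e₂
    ∎
    where
    open ≡-Reasoning
    swap : ∀ β d → β G.* d ≡ d G.* (β G.- G.0#)
    swap = G.solve 2 (λ β d → β G.:* d G.:= d G.:* (β G.:- G.con (ℤ.+ 0))) refl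

  X : G.Carrier → Diff → ℤ
  X β u = Ñ β u - Ã₃ u

  Σ-X : ∀ u → Σ-list G.elements (λ β → (1ℤ - δG β) * X β u) ≡ (1ℤ - δG (proj₁ u)) * (1ℤ - δF (proj₁ (proj₂ u)))
  Σ-X u@(d , e₁ , e₂) =
    begin
      Σ-list G.elements (λ β → (1ℤ - δG β) * X β u)
    ≡⟨ Σ-cong G.elements (λ β → split (δG β) (X β u)) ⟩
      Σ-list G.elements (λ β → X β u - δG β * X β u)
    ≡⟨ Σ-- G.elements (λ β → X β u) (λ β → δG β * X β u) ⟩
      Σ-list G.elements (λ β → Ñ β u - Ã₃ u) - Σ-list G.elements (λ β → δG β * X β u)
    ≡⟨ cong₂ _-_ (trans (Σ-- G.elements (λ β → Ñ β u) (λ _ → Ã₃ u)) (cong₂ _-_ (Σ-Ñ d e₁ e₂) (Σ-const G.elements (Ã₃ u))))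
                 (ΣG.Σ-elements-select G.0# (λ β → β G.≟ G.0#) (λ _ e → e) refl (λ β → X β u)) ⟩
      (1ℤ - δG d) * lineCount e₁ e₂ - g * Ã₃ u - (Ñ G.0# u - Ã₃ u)
    ≡⟨ cong₂ (λ h n → (1ℤ - δG d) * lineCount e₁ e₂ - h * Ã₃ u - (n - Ã₃ u))
             g≡1+q (cong (λ m → slopeIncidence m e₁ e₂) (φ-at-0 (G.*-zeroˡ d))) ⟩
      (1ℤ - δG d) * lineCount e₁ e₂ - (1ℤ + q) * Ã₃ u - (0ℤ - Ã₃ u)
    ≡⟨ simplify (δG d) (δF e₁) (δF e₂) q ⟩
      (1ℤ - δG d) * (1ℤ - δF e₁)
    ∎
    where
    open ≡-Reasoning
    split : ∀ D x → (1ℤ - D) * x ≡ x - D * x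
    split = solve-∀
    simplify : ∀ D E₁ E₂ q → (1ℤ - D) * (1ℤ - E₁ + q * (E₁ * E₂)) - (1ℤ + q) * ((1ℤ - D) * (E₁ * E₂)) - (0ℤ - (1ℤ - D) * (E₁ * E₂))
                            ≡ (1ℤ - D) * (1ℤ - E₁)
    simplify = solve-∀

  -- Kronecker-type difference functions: the combinations
  -- k₀ A₀ + k₁ A₁ + k₂ A₂ + k₃ A₃ + k₄ A₄ + k₅ Σ_{β≠0} A_{5,β}, which in
  -- difference form depend only on the vanishing pattern (D, E₁, E₂) of the
  -- difference.

  record Kron6 : Set where
    constructor ⟨_,_,_,_,_,_⟩
    field k₀ k₁ k₂ k₃ k₄ k₅ : ℤ
  open Kron6

  infixl 6 _⊞_ _⊟_
  _⊞_ _⊟_ : Kron6 → Kron6 → Kron6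
  κ ⊞ κ' = ⟨ k₀ κ + k₀ κ' , k₁ κ + k₁ κ' , k₂ κ + k₂ κ' , k₃ κ + k₃ κ' , k₄ κ + k₄ κ' , k₅ κ + k₅ κ' ⟩
  κ ⊟ κ' = ⟨ k₀ κ - k₀ κ' , k₁ κ - k₁ κ' , k₂ κ - k₂ κ' , k₃ κ - k₃ κ' , k₄ κ - k₄ κ' , k₅ κ - k₅ κ' ⟩

  basis : ℤ → ℤ → ℤ → Kron6
  basis D E₁ E₂ = ⟨ D * (E₁ * E₂) , D * (E₁ * (1ℤ - E₂)) , D * ((1ℤ - E₁) * 1ℤ) ,
                    (1ℤ - D) * (E₁ * E₂) , (1ℤ - D) * (E₁ * (1ℤ - E₂)) , (1ℤ - D) * (1ℤ - E₁) ⟩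

  vanishing : Diff → Kron6
  vanishing (d , e₁ , e₂) = basis (δG d) (δF e₁) (δF e₂)

  _·_ : Kron6 → Kron6 → ℤ
  κ · b = k₀ κ * k₀ b + k₁ κ * k₁ b + k₂ κ * k₂ b + k₃ κ * k₃ b + k₄ κ * k₄ b + k₅ κ * k₅ b

  ·-⊞ : ∀ κ κ' b → (κ ⊞ κ') · b ≡ κ · b + κ' · b
  ·-⊞ ⟨ a₀ , a₁ , a₂ , a₃ , a₄ , a₅ ⟩ ⟨ a₀' , a₁' , a₂' , a₃' , a₄' , a₅' ⟩ ⟨ b₀ , b₁ , b₂ , b₃ , b₄ , b₅ ⟩ =
    linear a₀ a₁ a₂ a₃ a₄ a₅ a₀' a₁' a₂' a₃' a₄' a₅' b₀ b₁ b₂ b₃ b₄ b₅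
    where
    linear : ∀ a₀ a₁ a₂ a₃ a₄ a₅ a₀' a₁' a₂' a₃' a₄' a₅' b₀ b₁ b₂ b₃ b₄ b₅ →
          (a₀ + a₀') * b₀ + (a₁ + a₁') * b₁ + (a₂ + a₂') * b₂ + (a₃ + a₃') * b₃ + (a₄ + a₄') * b₄ + (a₅ + a₅') * b₅
          ≡ (a₀ * b₀ + a₁ * b₁ + a₂ * b₂ + a₃ * b₃ + a₄ * b₄ + a₅ * b₅) + (a₀' * b₀ + a₁' * b₁ + a₂' * b₂ + a₃' * b₃ + a₄' * b₄ + a₅' * b₅)
    linear = solve-∀

  ·-⊟ : ∀ κ κ' b → (κ ⊟ κ') · b ≡ κ · b - κ' · b
  ·-⊟ ⟨ a₀ , a₁ , a₂ , a₃ , a₄ , a₅ ⟩ ⟨ a₀' , a₁' , a₂' , a₃' , a₄' , a₅' ⟩ ⟨ b₀ , b₁ , b₂ , b₃ , b₄ , b₅ ⟩ =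
    linear a₀ a₁ a₂ a₃ a₄ a₅ a₀' a₁' a₂' a₃' a₄' a₅' b₀ b₁ b₂ b₃ b₄ b₅
    where
    linear : ∀ a₀ a₁ a₂ a₃ a₄ a₅ a₀' a₁' a₂' a₃' a₄' a₅' b₀ b₁ b₂ b₃ b₄ b₅ →
          (a₀ - a₀') * b₀ + (a₁ - a₁') * b₁ + (a₂ - a₂') * b₂ + (a₃ - a₃') * b₃ + (a₄ - a₄') * b₄ + (a₅ - a₅') * b₅
          ≡ (a₀ * b₀ + a₁ * b₁ + a₂ * b₂ + a₃ * b₃ + a₄ * b₄ + a₅ * b₅) - (a₀' * b₀ + a₁' * b₁ + a₂' * b₂ + a₃' * b₃ + a₄' * b₄ + a₅' * b₅)
    linear = solve-∀

  -- A product of three affine functions of D, E₁, E₂ is of Kronecker type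
  -- when E₂ only matters where E₁ = 1 (t u = 0); its coefficients are its
  -- values at the six vanishing patterns.
  corners : (p r s t u v : ℤ) → Kron6
  corners p r s t u v = ⟨ (p + r) * ((s + t) * (u + v)) , (p + r) * ((s + t) * v) , (p + r) * (t * v) ,
                          r * ((s + t) * (u + v)) , r * ((s + t) * v) , r * (t * v) ⟩

  corner-expansion : ∀ p r s t u v D E₁ E₂ → t * u ≡ 0ℤ →
                     (p * D + r) * ((s * E₁ + t) * (u * E₂ + v)) ≡ corners p r s t u v · basis D E₁ E₂
  corner-expansion p r s t u v D E₁ E₂ tu≡0 =
    trans (expand p r s t u v D E₁ E₂)
          (trans (cong (λ z → corners p r s t u v · basis D E₁ E₂ + z * ((p * D + r) * ((1ℤ - E₁) * E₂))) tu≡0)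
                 (ℤP.+-identityʳ _))
    where
    expand : ∀ p r s t u v D E₁ E₂ → (p * D + r) * ((s * E₁ + t) * (u * E₂ + v)) ≡
      (p + r) * ((s + t) * (u + v)) * (D * (E₁ * E₂)) + (p + r) * ((s + t) * v) * (D * (E₁ * (1ℤ - E₂)))
      + (p + r) * (t * v) * (D * ((1ℤ - E₁) * 1ℤ)) + r * ((s + t) * (u + v)) * ((1ℤ - D) * (E₁ * E₂))
      + r * ((s + t) * v) * ((1ℤ - D) * (E₁ * (1ℤ - E₂))) + r * (t * v) * ((1ℤ - D) * (1ℤ - E₁))
      + t * u * ((p * D + r) * ((1ℤ - E₁) * E₂))
    expand = solve-∀

  -- Linear combinations of the classes.  A coefficient vector is given by a
  -- Kronecker part κ together with a list of extra weights v on single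
  -- classes A_{5,δ}.

  Weights : Set
  Weights = List (ℤ × G.Carrier)

  coeffs : Kron6 → Weights → Cls → ℤ
  coeffs κ ws c0 = k₀ κ
  coeffs κ ws c1 = k₁ κ
  coeffs κ ws c2 = k₂ κ
  coeffs κ ws c3 = k₃ κ
  coeffs κ ws c4 = k₄ κ
  coeffs κ ws (c5 β _) = k₅ κ + Σ-list ws (λ w → proj₁ w * ⟦ β G.≟ proj₂ w ⟧)

  Σ-A₅-classes : ∀ (f : Cls → ℤ) (h : G.Carrier → ℤ) → (∀ β p → f (c5 β p) ≡ h β) →
                 Σ-list (concatMap nz G.elements) f ≡ Σ-list G.elements (λ β → (1ℤ - δG β) * h β)
  Σ-A₅-classes f h f≡h = go G.elements
    where
    one : ∀ β → Σ-list (nz β) f ≡ (1ℤ - δG β) * h β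
    one β with β G.≟ G.0#
    ... | yes _ = refl
    ... | no _ = trans (ℤP.+-identityʳ _) (trans (f≡h β _) (sym (ℤP.*-identityˡ _)))
    go : ∀ xs → Σ-list (concatMap nz xs) f ≡ Σ-list xs (λ β → (1ℤ - δG β) * h β)
    go [] = refl
    go (β ∷ xs) = trans (Σ-++ (nz β) (concatMap nz xs) f) (cong₂ _+_ (one β) (go xs))

  Σ-X-select : ∀ δ → G.NonZero δ → ∀ u → Σ-list G.elements (λ β → (1ℤ - δG β) * (⟦ β G.≟ δ ⟧ * X β u)) ≡ X δ u
  Σ-X-select δ δ≢0 u =
    begin
      Σ-list G.elements (λ β → (1ℤ - δG β) * (⟦ β G.≟ δ ⟧ * X β u))
    ≡⟨ Σ-cong G.elements (λ β → reorder (δG β) ⟦ β G.≟ δ ⟧ (X β u)) ⟩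
      Σ-list G.elements (λ β → ⟦ β G.≟ δ ⟧ * ((1ℤ - δG β) * X β u))
    ≡⟨ ΣG.Σ-elements-select δ (λ β → β G.≟ δ) (λ _ e → e) refl (λ β → (1ℤ - δG β) * X β u) ⟩
      (1ℤ - δG δ) * X δ u
    ≡⟨ cong (λ z → (1ℤ - z) * X δ u) (⟦⟧-no (δ G.≟ G.0#) δ≢0) ⟩
      (1ℤ - 0ℤ) * X δ u
    ≡⟨ ℤP.*-identityˡ (X δ u) ⟩
      X δ u
    ∎
    where
    open ≡-Reasoning
    reorder : ∀ D I x → (1ℤ - D) * (I * x) ≡ I * ((1ℤ - D) * x)
    reorder = solve-∀

  Σ-weights : ∀ ws → All (λ w → G.NonZero (proj₂ w)) ws → ∀ u →
    Σ-list G.elements (λ β → (1ℤ - δG β) * (Σ-list ws (λ w → proj₁ w * ⟦ β G.≟ proj₂ w ⟧) * X β u))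
    ≡ Σ-list ws (λ w → proj₁ w * X (proj₂ w) u)
  Σ-weights [] [] u = Σ-zero G.elements (All.universal (λ β → ℤP.*-zeroʳ (1ℤ - δG β)) G.elements)
  Σ-weights ((v , δ) ∷ ws) (δ≢0 ∷ ws≢0) u =
    begin
      Σ-list G.elements (λ β → (1ℤ - δG β) * ((v * I β + W β) * X β u))
    ≡⟨ Σ-cong G.elements (λ β → split (δG β) v (I β) (W β) (X β u)) ⟩
      Σ-list G.elements (λ β → v * ((1ℤ - δG β) * (I β * X β u)) + (1ℤ - δG β) * (W β * X β u))
    ≡⟨ Σ-+ G.elements (λ β → v * ((1ℤ - δG β) * (I β * X β u))) (λ β → (1ℤ - δG β) * (W β * X β u)) ⟩
      Σ-list G.elements (λ β → v * ((1ℤ - δG β) * (I β * X β u))) + Σ-list G.elements (λ β → (1ℤ - δG β) * (W β * X β u))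
    ≡⟨ cong₂ _+_ (trans (Σ-*ˡ G.elements v (λ β → (1ℤ - δG β) * (I β * X β u))) (cong (v *_) (Σ-X-select δ δ≢0 u))) (Σ-weights ws ws≢0 u) ⟩
      v * X δ u + Σ-list ws (λ w → proj₁ w * X (proj₂ w) u)
    ∎
    where
    open ≡-Reasoning
    I W : G.Carrier → ℤ
    I β = ⟦ β G.≟ δ ⟧
    W β = Σ-list ws (λ w → proj₁ w * ⟦ β G.≟ proj₂ w ⟧)
    split : ∀ D v I W x → (1ℤ - D) * ((v * I + W) * x) ≡ v * ((1ℤ - D) * (I * x)) + (1ℤ - D) * (W * x)
    split = solve-∀

  combination : ∀ κ ws → All (λ w → G.NonZero (proj₂ w)) ws → ∀ u →
    Σ-list classes (λ k → coeffs κ ws k * Ã k u) ≡ κ · vanishing u + Σ-list ws (λ w → proj₁ w * X (proj₂ w) u)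
  combination κ ws ws≢0 u@(d , e₁ , e₂) =
    trans (cong (λ t → k₀ κ * Ã c0 u + (k₁ κ * Ã c1 u + (k₂ κ * Ã c2 u + (k₃ κ * Ã c3 u + (k₄ κ * Ã c4 u + t))))) A₅-part)
          (collect (k₀ κ) (k₁ κ) (k₂ κ) (k₃ κ) (k₄ κ) (k₅ κ) (Ã c0 u) (Ã c1 u) (Ã c2 u) (Ã c3 u) (Ã c4 u)
                   ((1ℤ - δG d) * (1ℤ - δF e₁)) V)
    where
    open ≡-Reasoning
    W : G.Carrier → ℤ
    W β = Σ-list ws (λ w → proj₁ w * ⟦ β G.≟ proj₂ w ⟧)
    V : ℤ
    V = Σ-list ws (λ w → proj₁ w * X (proj₂ w) u)
    split : ∀ D k W x → (1ℤ - D) * ((k + W) * x) ≡ k * ((1ℤ - D) * x) + (1ℤ - D) * (W * x)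
    split = solve-∀
    A₅-part : Σ-list (concatMap nz G.elements) (λ k → coeffs κ ws k * Ã k u) ≡ k₅ κ * ((1ℤ - δG d) * (1ℤ - δF e₁)) + V
    A₅-part =
      begin
        Σ-list (concatMap nz G.elements) (λ k → coeffs κ ws k * Ã k u)
      ≡⟨ Σ-A₅-classes (λ k → coeffs κ ws k * Ã k u) (λ β → (k₅ κ + W β) * X β u) (λ β p → refl) ⟩
        Σ-list G.elements (λ β → (1ℤ - δG β) * ((k₅ κ + W β) * X β u))
      ≡⟨ trans (Σ-cong G.elements (λ β → split (δG β) (k₅ κ) (W β) (X β u))) (Σ-+ G.elements (λ β → k₅ κ * ((1ℤ - δG β) * X β u)) (λ β → (1ℤ - δG β) * (W β * X β u))) ⟩
        Σ-list G.elements (λ β → k₅ κ * ((1ℤ - δG β) * X β u)) + Σ-list G.elements (λ β → (1ℤ - δG β) * (W β * X β u))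
      ≡⟨ cong₂ _+_ (trans (Σ-*ˡ G.elements (k₅ κ) (λ β → (1ℤ - δG β) * X β u)) (cong (k₅ κ *_) (Σ-X u))) (Σ-weights ws ws≢0 u) ⟩
        k₅ κ * ((1ℤ - δG d) * (1ℤ - δF e₁)) + V
      ∎
    collect : ∀ k₀ k₁ k₂ k₃ k₄ k₅ b₀ b₁ b₂ b₃ b₄ b₅ V →
      k₀ * b₀ + (k₁ * b₁ + (k₂ * b₂ + (k₃ * b₃ + (k₄ * b₄ + (k₅ * b₅ + V)))))
      ≡ k₀ * b₀ + k₁ * b₁ + k₂ * b₂ + k₃ * b₃ + k₄ * b₄ + k₅ * b₅ + V
    collect = solve-∀

  Closed : Cls → Cls → Set
  Closed i j = Σ (Cls → ℤ) λ c → ∀ x y → mul TX (A i) (A j) x y ≡ Σ-list classes (λ k → c k * A k x y)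

  closed-by : ∀ i j κ ws → All (λ w → G.NonZero (proj₂ w)) ws →
    (∀ x y → mul TX (A i) (A j) x y ≡ κ · vanishing (diff x y) + Σ-list ws (λ w → proj₁ w * X (proj₂ w) (diff x y))) →
    Closed i j
  closed-by i j κ ws ws≢0 product = coeffs κ ws , λ x y →
    trans (product x y)
          (trans (sym (combination κ ws ws≢0 (diff x y)))
                 (Σ-cong classes (λ k → cong (coeffs κ ws k *_) (sym (A-diff k x y)))))

  record Shape : Set where
    constructor shape
    field α₁ β₁ α₂ β₂ α₃ β₃ : ℤ
  open Shape

  Kron : Shape → Mat Pt
  Kron σ = IJ TG (α₁ σ) (β₁ σ) ⊗ (IJ TF (α₂ σ) (β₂ σ) ⊗ IJ TF (α₃ σ) (β₃ σ))

  _∙_ : Shape → Shape → Shape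
  σ ∙ τ = shape (α₁ σ * α₁ τ) (α₁ σ * β₁ τ + β₁ σ * α₁ τ + g * β₁ σ * β₁ τ)
                (α₂ σ * α₂ τ) (α₂ σ * β₂ τ + β₂ σ * α₂ τ + q * β₂ σ * β₂ τ)
                (α₃ σ * α₃ τ) (α₃ σ * β₃ τ + β₃ σ * α₃ τ + q * β₃ σ * β₃ τ)

  Kron-mul : ∀ σ τ x y → mul TX (Kron σ) (Kron τ) x y ≡ Kron (σ ∙ τ) x y
  Kron-mul σ τ (b , x₁ , x₂) (b' , y₁ , y₂) =
    trans (kron-mul TG (TF ×ᶠ TF) (IJ TG (α₁ σ) (β₁ σ)) (IJ TG (α₁ τ) (β₁ τ))
                    (IJ TF (α₂ σ) (β₂ σ) ⊗ IJ TF (α₃ σ) (β₃ σ)) (IJ TF (α₂ τ) (β₂ τ) ⊗ IJ TF (α₃ τ) (β₃ τ)) b (x₁ , x₂) b' (y₁ , y₂))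
      (cong₂ _*_ (IJ-mul TG G.elements-unique G.elements-complete (α₁ σ) (β₁ σ) (α₁ τ) (β₁ τ) b b')
        (trans (kron-mul TF TF (IJ TF (α₂ σ) (β₂ σ)) (IJ TF (α₂ τ) (β₂ τ)) (IJ TF (α₃ σ) (β₃ σ)) (IJ TF (α₃ τ) (β₃ τ)) x₁ x₂ y₁ y₂)
               (cong₂ _*_ (IJ-mul TF F.elements-unique F.elements-complete (α₂ σ) (β₂ σ) (α₂ τ) (β₂ τ) x₁ y₁)
                          (IJ-mul TF F.elements-unique F.elements-complete (α₃ σ) (β₃ σ) (α₃ τ) (β₃ τ) x₂ y₂))))

  -- A shape is admissible when its middle factor has a J-part only if its
  -- last factor is J; admissible shapes are closed under products.
  Admissible : Shape → Set
  Admissible σ = β₂ σ * α₃ σ ≡ 0ℤ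

  ∙-admissible : ∀ σ τ → Admissible σ → Admissible τ → Admissible (σ ∙ τ)
  ∙-admissible σ τ adm-σ adm-τ =
    begin
      (α₂ σ * β₂ τ + β₂ σ * α₂ τ + q * β₂ σ * β₂ τ) * (α₃ σ * α₃ τ)
    ≡⟨ regroup (α₂ σ) (β₂ σ) (α₃ σ) (α₂ τ) (β₂ τ) (α₃ τ) q ⟩
      (β₂ τ * α₃ τ) * (α₂ σ * α₃ σ) + (β₂ σ * α₃ σ) * (α₂ τ * α₃ τ + q * (β₂ τ * α₃ τ))
    ≡⟨ cong₂ (λ s t → s * (α₂ σ * α₃ σ) + t * (α₂ τ * α₃ τ + q * s)) adm-τ adm-σ ⟩
      0ℤ * (α₂ σ * α₃ σ) + 0ℤ * (α₂ τ * α₃ τ + q * 0ℤ)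
    ≡⟨ vanish (α₂ σ * α₃ σ) (α₂ τ * α₃ τ) q ⟩
      0ℤ
    ∎
    where
    open ≡-Reasoning
    regroup : ∀ a b c a' b' c' q → (a * b' + b * a' + q * b * b') * (c * c')
                                  ≡ (b' * c') * (a * c) + (b * c) * (a' * c' + q * (b' * c'))
    regroup = solve-∀
    vanish : ∀ s t q → 0ℤ * s + 0ℤ * (t + q * 0ℤ) ≡ 0ℤ
    vanish = solve-∀

  Kron-diff : ∀ σ x y → let (d , e₁ , e₂) = diff x y in
    Kron σ x y ≡ (α₁ σ * δG d + β₁ σ) * ((α₂ σ * δF e₁ + β₂ σ) * (α₃ σ * δF e₂ + β₃ σ))
  Kron-diff σ (b , a₁ , a₂) (b' , a₁' , a₂') rewrite δG-diff b b' | δF-diff a₁ a₁' | δF-diff a₂ a₂' = refl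

  shapeCorners : Shape → Kron6
  shapeCorners σ = corners (α₁ σ) (β₁ σ) (α₂ σ) (β₂ σ) (α₃ σ) (β₃ σ)

  Kron-span : ∀ σ → Admissible σ → ∀ x y → Kron σ x y ≡ shapeCorners σ · vanishing (diff x y)
  Kron-span σ adm x y =
    trans (Kron-diff σ x y) (corner-expansion (α₁ σ) (β₁ σ) (α₂ σ) (β₂ σ) (α₃ σ) (β₃ σ) _ _ _ adm)

  data KronClass : Set where
    kc0 kc1 kc2 kc3 kc4 : KronClass

  cls : KronClass → Cls
  cls kc0 = c0
  cls kc1 = c1
  cls kc2 = c2
  cls kc3 = c3
  cls kc4 = c4

  -- I = 1 I + 0 J, J - I = -1 I + 1 J, J = 0 I + 1 J
  shapeOf : KronClass → Shape
  shapeOf kc0 = shape 1ℤ 0ℤ 1ℤ 0ℤ 1ℤ 0ℤ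
  shapeOf kc1 = shape 1ℤ 0ℤ 1ℤ 0ℤ (- 1ℤ) 1ℤ
  shapeOf kc2 = shape 1ℤ 0ℤ (- 1ℤ) 1ℤ 0ℤ 1ℤ
  shapeOf kc3 = shape (- 1ℤ) 1ℤ 1ℤ 0ℤ 1ℤ 0ℤ
  shapeOf kc4 = shape (- 1ℤ) 1ℤ 1ℤ 0ℤ (- 1ℤ) 1ℤ

  σ₃ : Shape
  σ₃ = shapeOf kc3

  shapeOf-admissible : ∀ k → Admissible (shapeOf k)
  shapeOf-admissible kc0 = refl
  shapeOf-admissible kc1 = refl
  shapeOf-admissible kc2 = refl
  shapeOf-admissible kc3 = refl
  shapeOf-admissible kc4 = refl

  A-Kron : ∀ k x y → A (cls k) x y ≡ Kron (shapeOf k) x y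
  A-Kron k (b , a₁ , a₂) (b' , a₁' , a₂') = factors k
    where
    I-form : ∀ x → x ≡ 1ℤ * x + 0ℤ
    I-form = solve-∀
    J-I-form : ∀ x → 1ℤ - x ≡ - 1ℤ * x + 1ℤ
    J-I-form = solve-∀
    J-form : ∀ x → 1ℤ ≡ 0ℤ * x + 1ℤ
    J-form = solve-∀
    B E₁ E₂ : ℤ
    B = ⟦ b G.≟ b' ⟧
    E₁ = ⟦ a₁ F.≟ a₁' ⟧
    E₂ = ⟦ a₂ F.≟ a₂' ⟧
    factors : ∀ k → A (cls k) (b , a₁ , a₂) (b' , a₁' , a₂') ≡ Kron (shapeOf k) (b , a₁ , a₂) (b' , a₁' , a₂')
    factors kc0 = cong₂ _*_ (I-form B) (cong₂ _*_ (I-form E₁) (I-form E₂))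
    factors kc1 = cong₂ _*_ (I-form B) (cong₂ _*_ (I-form E₁) (J-I-form E₂))
    factors kc2 = cong₂ _*_ (I-form B) (cong₂ _*_ (J-I-form E₁) (J-form E₂))
    factors kc3 = cong₂ _*_ (J-I-form B) (cong₂ _*_ (I-form E₁) (I-form E₂))
    factors kc4 = cong₂ _*_ (J-I-form B) (cong₂ _*_ (I-form E₁) (J-I-form E₂))

  Kron-closed : ∀ k k' → Closed (cls k) (cls k')
  Kron-closed k k' = closed-by (cls k) (cls k') (shapeCorners (shapeOf k ∙ shapeOf k')) [] [] λ x y →
    begin
      mul TX (A (cls k)) (A (cls k')) x y
    ≡⟨ mul-cong TX (A-Kron k) (A-Kron k') x y ⟩
      mul TX (Kron (shapeOf k)) (Kron (shapeOf k')) x y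
    ≡⟨ Kron-mul (shapeOf k) (shapeOf k') x y ⟩
      Kron (shapeOf k ∙ shapeOf k') x y
    ≡⟨ Kron-span (shapeOf k ∙ shapeOf k') (∙-admissible (shapeOf k) (shapeOf k') (shapeOf-admissible k) (shapeOf-admissible k')) x y ⟩
      shapeCorners (shapeOf k ∙ shapeOf k') · vanishing (diff x y)
    ≡⟨ sym (ℤP.+-identityʳ _) ⟩
      shapeCorners (shapeOf k ∙ shapeOf k') · vanishing (diff x y) + 0ℤ
    ∎
    where open ≡-Reasoning

  -- Products N_β · Kron σ.  Summing over a middle point z, N_β(x, z) forces
  -- z to lie on the line through x of slope φ(β (b_z - b_x)).

  Σ-on-line : ∀ c x₁ x₂ z₁ (h : F.Carrier → ℤ) →
    Σ-list F.elements (λ z₂ → slopeIncidence (just c) (z₁ F.- x₁) (z₂ F.- x₂) * h z₂) ≡ h (F.line x₁ x₂ c z₁)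
  Σ-on-line c x₁ x₂ z₁ h =
    ΣF.Σ-elements-select (F.line x₁ x₂ c z₁) (λ z₂ → (z₂ F.- x₂) F.≟ (c F.* (z₁ F.- x₁)))
                         (F.line-unique x₁ x₂ c z₁) (F.line-correct x₁ x₂ c z₁) h

  line-incidence : ∀ c x₁ x₂ y₁ y₂ → ⟦ F.line x₁ x₂ c y₁ F.≟ y₂ ⟧ ≡ slopeIncidence (just c) (y₁ F.- x₁) (y₂ F.- x₂)
  line-incidence c x₁ x₂ y₁ y₂ =
    ⟦⟧-iff (F.line x₁ x₂ c y₁ F.≟ y₂) ((y₂ F.- x₂) F.≟ (c F.* (y₁ F.- x₁)))
           (λ e → trans (cong (F._- x₂) (sym e)) (F.line-correct x₁ x₂ c y₁))
           (λ e → sym (F.line-unique x₁ x₂ c y₁ y₂ e))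

  -- the weight a line through x picks up from the 𝔽_q²-part of an admissible shape
  lineWeight : (α₂ β₂ α₃ β₃ : ℤ) → ℤ
  lineWeight α₂ β₂ α₃ β₃ = α₂ * β₃ + q * β₂ * β₃

  Σ-line-Kron : ∀ m x₁ x₂ y₁ y₂ α₂ β₂ α₃ β₃ → β₂ * α₃ ≡ 0ℤ →
    Σ-list F.elements (λ z₁ → Σ-list F.elements (λ z₂ →
       slopeIncidence m (z₁ F.- x₁) (z₂ F.- x₂) * ((α₂ * ⟦ z₁ F.≟ y₁ ⟧ + β₂) * (α₃ * ⟦ z₂ F.≟ y₂ ⟧ + β₃))))
    ≡ finite m * lineWeight α₂ β₂ α₃ β₃ + (α₂ * α₃) * slopeIncidence m (y₁ F.- x₁) (y₂ F.- x₂)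
  Σ-line-Kron nothing x₁ x₂ y₁ y₂ α₂ β₂ α₃ β₃ adm =
    trans (Σ-zero F.elements (All.universal (λ z₁ → Σ-zero F.elements (All.universal (λ z₂ → ℤP.*-zeroˡ ((α₂ * ⟦ z₁ F.≟ y₁ ⟧ + β₂) * (α₃ * ⟦ z₂ F.≟ y₂ ⟧ + β₃))) F.elements)) F.elements))
          (vanish (lineWeight α₂ β₂ α₃ β₃) (α₂ * α₃))
    where
    vanish : ∀ C a → 0ℤ ≡ 0ℤ * C + a * 0ℤ
    vanish = solve-∀
  Σ-line-Kron (just c) x₁ x₂ y₁ y₂ α₂ β₂ α₃ β₃ adm =
    begin
      Σ-list F.elements (λ z₁ → Σ-list F.elements (λ z₂ → slopeIncidence (just c) (z₁ F.- x₁) (z₂ F.- x₂) * (K z₁ * L z₂)))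
    ≡⟨ Σ-cong F.elements (λ z₁ → Σ-on-line c x₁ x₂ z₁ (λ z₂ → K z₁ * L z₂)) ⟩
      Σ-list F.elements (λ z₁ → K z₁ * L (ℓ z₁))
    ≡⟨ Σ-cong F.elements (λ z₁ → expand α₂ β₂ α₃ β₃ ⟦ z₁ F.≟ y₁ ⟧ ⟦ ℓ z₁ F.≟ y₂ ⟧) ⟩
      Σ-list F.elements (λ z₁ → ⟦ z₁ F.≟ y₁ ⟧ * (α₂ * L (ℓ z₁)) + (β₂ * α₃) * ⟦ ℓ z₁ F.≟ y₂ ⟧ + β₂ * β₃)
    ≡⟨ trans (Σ-+ F.elements (λ z₁ → P z₁ + Q z₁) (λ _ → β₂ * β₃)) (cong₂ _+_ (Σ-+ F.elements P Q) (ΣF.Σ-elements-const (β₂ * β₃))) ⟩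
      Σ-list F.elements P + Σ-list F.elements Q + q * (β₂ * β₃)
    ≡⟨ cong₂ (λ s t → s + t + q * (β₂ * β₃))
             (ΣF.Σ-elements-select y₁ (λ z₁ → z₁ F.≟ y₁) (λ _ e → e) refl (λ z₁ → α₂ * L (ℓ z₁)))
             (trans (Σ-*ˡ F.elements (β₂ * α₃) (λ z₁ → ⟦ ℓ z₁ F.≟ y₂ ⟧))
                    (trans (cong (_* Σ-list F.elements (λ z₁ → ⟦ ℓ z₁ F.≟ y₂ ⟧)) adm) (ℤP.*-zeroˡ (Σ-list F.elements (λ z₁ → ⟦ ℓ z₁ F.≟ y₂ ⟧))))) ⟩
      α₂ * (α₃ * ⟦ ℓ y₁ F.≟ y₂ ⟧ + β₃) + 0ℤ + q * (β₂ * β₃)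
    ≡⟨ cong (λ n → α₂ * (α₃ * n + β₃) + 0ℤ + q * (β₂ * β₃)) (line-incidence c x₁ x₂ y₁ y₂) ⟩
      α₂ * (α₃ * n₀ + β₃) + 0ℤ + q * (β₂ * β₃)
    ≡⟨ collect α₂ β₂ α₃ β₃ q n₀ ⟩
      1ℤ * lineWeight α₂ β₂ α₃ β₃ + (α₂ * α₃) * n₀
    ∎
    where
    open ≡-Reasoning
    K L : F.Carrier → ℤ
    K z₁ = α₂ * ⟦ z₁ F.≟ y₁ ⟧ + β₂
    L z₂ = α₃ * ⟦ z₂ F.≟ y₂ ⟧ + β₃
    ℓ : F.Carrier → F.Carrier
    ℓ = F.line x₁ x₂ c
    P Q : F.Carrier → ℤ
    P z₁ = ⟦ z₁ F.≟ y₁ ⟧ * (α₂ * L (ℓ z₁))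
    Q z₁ = (β₂ * α₃) * ⟦ ℓ z₁ F.≟ y₂ ⟧
    n₀ : ℤ
    n₀ = slopeIncidence (just c) (y₁ F.- x₁) (y₂ F.- x₂)
    expand : ∀ α₂ β₂ α₃ β₃ P Q → (α₂ * P + β₂) * (α₃ * Q + β₃) ≡ P * (α₂ * (α₃ * Q + β₃)) + (β₂ * α₃) * Q + β₂ * β₃
    expand = solve-∀
    collect : ∀ α₂ β₂ α₃ β₃ q n → α₂ * (α₃ * n + β₃) + 0ℤ + q * (β₂ * β₃) ≡ 1ℤ * (α₂ * β₃ + q * β₂ * β₃) + (α₂ * α₃) * n
    collect = solve-∀

  N-Kron : Shape → G.Carrier → Diff → ℤ
  N-Kron σ β u@(d , e₁ , e₂) =
    α₁ σ * ((1ℤ - δG d) * W + (α₂ σ * α₃ σ) * Ñ β u) + β₁ σ * (q * W + (α₂ σ * α₃ σ) * lineCount e₁ e₂)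
    where
    W : ℤ
    W = lineWeight (α₂ σ) (β₂ σ) (α₃ σ) (β₃ σ)

  N-Kron-product : ∀ β → G.NonZero β → ∀ σ → Admissible σ → ∀ x y → mul TX (N β) (Kron σ) x y ≡ N-Kron σ β (diff x y)
  N-Kron-product β β≢0 σ@(shape α₁ β₁ α₂ β₂ α₃ β₃) adm x@(b , x₁ , x₂) y@(b'' , y₁ , y₂) =
    begin
      mul TX (N β) (Kron σ) x y
    ≡⟨ mul-ΣPt (N β) (Kron σ) x y ⟩
      ΣPt (λ z → N β x z * Kron σ z y)
    ≡⟨ Σ-cong G.elements (λ b' → trans (Σ-cong F.elements (λ z₁ → trans (Σ-cong F.elements (λ z₂ → factor b' z₁ z₂))
                                                                         (Σ-*ˡ F.elements (O b') (λ z₂ → inner b' z₁ z₂))))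
                                       (Σ-*ˡ F.elements (O b') (λ z₁ → Σ-list F.elements (inner b' z₁)))) ⟩
      Σ-list G.elements (λ b' → O b' * Σ-list F.elements (λ z₁ → Σ-list F.elements (inner b' z₁)))
    ≡⟨ Σ-cong G.elements (λ b' → trans (cong (O b' *_) (Σ-line-Kron (m b') x₁ x₂ y₁ y₂ α₂ β₂ α₃ β₃ adm))
                                       (distribute α₁ β₁ ⟦ b' G.≟ b'' ⟧ (R b'))) ⟩
      Σ-list G.elements (λ b' → ⟦ b' G.≟ b'' ⟧ * (α₁ * R b') + β₁ * R b')
    ≡⟨ Σ-+ G.elements (λ b' → ⟦ b' G.≟ b'' ⟧ * (α₁ * R b')) (λ b' → β₁ * R b') ⟩
      Σ-list G.elements (λ b' → ⟦ b' G.≟ b'' ⟧ * (α₁ * R b')) + Σ-list G.elements (λ b' → β₁ * R b')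
    ≡⟨ cong₂ _+_ (ΣG.Σ-elements-select b'' (λ b' → b' G.≟ b'') (λ _ e → e) refl (λ b' → α₁ * R b'))
                 (Σ-*ˡ G.elements β₁ R) ⟩
      α₁ * R b'' + β₁ * Σ-list G.elements R
    ≡⟨ cong₂ (λ f s → α₁ * (f * W + a * slopeIncidence (m b'') e₁ e₂) + β₁ * s) (finite-φ β (b'' G.- b) β≢0) ΣR ⟩
      N-Kron σ β (diff x y)
    ∎
    where
    open ≡-Reasoning
    e₁ e₂ : F.Carrier
    e₁ = y₁ F.- x₁
    e₂ = y₂ F.- x₂
    a W : ℤ
    a = α₂ * α₃
    W = lineWeight α₂ β₂ α₃ β₃
    m : G.Carrier → Maybe F.Carrier
    m b' = φ→ (β G.* (b' G.- b))
    O : G.Carrier → ℤ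
    O b' = α₁ * ⟦ b' G.≟ b'' ⟧ + β₁
    inner : G.Carrier → F.Carrier → F.Carrier → ℤ
    inner b' z₁ z₂ = slopeIncidence (m b') (z₁ F.- x₁) (z₂ F.- x₂) * ((α₂ * ⟦ z₁ F.≟ y₁ ⟧ + β₂) * (α₃ * ⟦ z₂ F.≟ y₂ ⟧ + β₃))
    R : G.Carrier → ℤ
    R b' = finite (m b') * W + a * slopeIncidence (m b') e₁ e₂
    factor : ∀ b' z₁ z₂ → N β x (b' , z₁ , z₂) * Kron σ (b' , z₁ , z₂) y ≡ O b' * inner b' z₁ z₂
    factor b' z₁ z₂ = trans (cong (_* Kron σ (b' , z₁ , z₂) y) (N-diff β b x₁ x₂ b' z₁ z₂))
                            (reorder (slopeIncidence (m b') (z₁ F.- x₁) (z₂ F.- x₂)) (O b') (α₂ * ⟦ z₁ F.≟ y₁ ⟧ + β₂) (α₃ * ⟦ z₂ F.≟ y₂ ⟧ + β₃))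
      where
      reorder : ∀ n o k l → n * (o * (k * l)) ≡ o * (n * (k * l))
      reorder = solve-∀
    distribute : ∀ α₁ β₁ I r → (α₁ * I + β₁) * r ≡ I * (α₁ * r) + β₁ * r
    distribute = solve-∀
    ΣR : Σ-list G.elements R ≡ q * W + a * lineCount e₁ e₂
    ΣR =
      begin
        Σ-list G.elements R
      ≡⟨ Σ-slopes-affine β b β≢0 (λ n → finite n * W + a * slopeIncidence n e₁ e₂) ⟩
        0ℤ * W + a * 0ℤ + Σ-list F.elements (λ s → 1ℤ * W + a * ⟦ e₂ F.≟ (s F.* e₁) ⟧)
      ≡⟨ cong (0ℤ * W + a * 0ℤ +_) (trans (Σ-+ F.elements (λ _ → 1ℤ * W) (λ s → a * ⟦ e₂ F.≟ (s F.* e₁) ⟧))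
            (cong₂ _+_ (ΣF.Σ-elements-const (1ℤ * W))
                       (trans (Σ-*ˡ F.elements a (λ s → ⟦ e₂ F.≟ (s F.* e₁) ⟧)) (cong (a *_) (ΣF.Σ-slopes e₁ e₂))))) ⟩
        0ℤ * W + a * 0ℤ + (q * (1ℤ * W) + a * lineCount e₁ e₂)
      ≡⟨ simplify W a q (lineCount e₁ e₂) ⟩
        q * W + a * lineCount e₁ e₂
      ∎
      where
      simplify : ∀ W a q L → 0ℤ * W + a * 0ℤ + (q * (1ℤ * W) + a * L) ≡ q * W + a * L
      simplify = solve-∀

  N-Kron-corners : Shape → Kron6
  N-Kron-corners σ = ⟨ b₁ * q * W + b₁ * a * q , b₁ * q * W , b₁ * q * W + b₁ * a ,
                       a₁ * W + a₁ * a + b₁ * q * W + b₁ * a * q , a₁ * W + b₁ * q * W , a₁ * W + b₁ * q * W + b₁ * a ⟩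
    where
    a₁ b₁ a W : ℤ
    a₁ = α₁ σ
    b₁ = β₁ σ
    a = α₂ σ * α₃ σ
    W = lineWeight (α₂ σ) (β₂ σ) (α₃ σ) (β₃ σ)

  N-Kron-span : ∀ σ β u → N-Kron σ β u ≡ N-Kron-corners σ · vanishing u + α₁ σ * (α₂ σ * α₃ σ) * X β u
  N-Kron-span σ β (d , e₁ , e₂) =
    expand (α₁ σ) (β₁ σ) (α₂ σ * α₃ σ) (lineWeight (α₂ σ) (β₂ σ) (α₃ σ) (β₃ σ)) q (δG d) (δF e₁) (δF e₂) (Ñ β (d , e₁ , e₂))
    where
    expand : ∀ a₁ b₁ a W q D E₁ E₂ N →
      a₁ * ((1ℤ - D) * W + a * N) + b₁ * (q * W + a * (1ℤ - E₁ + q * (E₁ * E₂))) ≡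
      (b₁ * q * W + b₁ * a * q) * (D * (E₁ * E₂)) + b₁ * q * W * (D * (E₁ * (1ℤ - E₂)))
      + (b₁ * q * W + b₁ * a) * (D * ((1ℤ - E₁) * 1ℤ))
      + (a₁ * W + a₁ * a + b₁ * q * W + b₁ * a * q) * ((1ℤ - D) * (E₁ * E₂))
      + (a₁ * W + b₁ * q * W) * ((1ℤ - D) * (E₁ * (1ℤ - E₂))) + (a₁ * W + b₁ * q * W + b₁ * a) * ((1ℤ - D) * (1ℤ - E₁))
      + a₁ * a * (N - (1ℤ - D) * (E₁ * E₂))
    expand = solve-∀

  A₅-Kron-closed : ∀ β p k → Closed (c5 β p) (cls k)
  A₅-Kron-closed β p k =
    closed-by (c5 β p) (cls k) (N-Kron-corners σ ⊟ shapeCorners (σ₃ ∙ σ)) ((c , β) ∷ []) (nonZero-of β p ∷ []) product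
    where
    open ≡-Reasoning
    σ : Shape
    σ = shapeOf k
    adm : Admissible σ
    adm = shapeOf-admissible k
    c : ℤ
    c = α₁ σ * (α₂ σ * α₃ σ)
    regroup : ∀ s t r → s + r - t ≡ s - t + (r + 0ℤ)
    regroup = solve-∀
    product : ∀ x y → mul TX (N β -ₘ A₃) (A (cls k)) x y
              ≡ (N-Kron-corners σ ⊟ shapeCorners (σ₃ ∙ σ)) · vanishing (diff x y) + (c * X β (diff x y) + 0ℤ)
    product x y =
      begin
        mul TX (N β -ₘ A₃) (A (cls k)) x y
      ≡⟨ mul-distribʳ-- TX (N β) A₃ (A (cls k)) x y ⟩
        mul TX (N β) (A (cls k)) x y - mul TX A₃ (A (cls k)) x y
      ≡⟨ cong₂ _-_ (mul-cong TX {N β} {N β} (λ _ _ → refl) (A-Kron k) x y) (mul-cong TX (A-Kron kc3) (A-Kron k) x y) ⟩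
        mul TX (N β) (Kron σ) x y - mul TX (Kron σ₃) (Kron σ) x y
      ≡⟨ cong₂ _-_ (trans (N-Kron-product β (nonZero-of β p) σ adm x y) (N-Kron-span σ β (diff x y)))
                   (trans (Kron-mul σ₃ σ x y) (Kron-span (σ₃ ∙ σ) (∙-admissible σ₃ σ refl adm) x y)) ⟩
        N-Kron-corners σ · v + c * X β (diff x y) - shapeCorners (σ₃ ∙ σ) · v
      ≡⟨ regroup (N-Kron-corners σ · v) (shapeCorners (σ₃ ∙ σ) · v) (c * X β (diff x y)) ⟩
        N-Kron-corners σ · v - shapeCorners (σ₃ ∙ σ) · v + (c * X β (diff x y) + 0ℤ)
      ≡⟨ cong (_+ (c * X β (diff x y) + 0ℤ)) (sym (·-⊟ (N-Kron-corners σ) (shapeCorners (σ₃ ∙ σ)) v)) ⟩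
        (N-Kron-corners σ ⊟ shapeCorners (σ₃ ∙ σ)) · v + (c * X β (diff x y) + 0ℤ)
      ∎
      where
      v : Kron6
      v = vanishing (diff x y)

  _≟M_ : (m m' : Maybe F.Carrier) → Dec (m ≡ m')
  _≟M_ = MaybeP.≡-dec F._≟_

  -- The common points of the line through x of slope m₁ and the line
  -- through y of slope m₂: one point if the slopes differ, q points or none
  -- if they agree.
  Σ-two-lines : ∀ m₁ m₂ x₁ x₂ y₁ y₂ →
    Σ-list F.elements (λ z₁ → Σ-list F.elements (λ z₂ →
      slopeIncidence m₁ (z₁ F.- x₁) (z₂ F.- x₂) * slopeIncidence m₂ (y₁ F.- z₁) (y₂ F.- z₂)))
    ≡ finite m₁ * finite m₂ + ⟦ m₁ ≟M m₂ ⟧ * (q * slopeIncidence m₁ (y₁ F.- x₁) (y₂ F.- x₂) - finite m₁)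
  Σ-two-lines nothing m₂ x₁ x₂ y₁ y₂ =
    trans (Σ-zero F.elements (All.universal (λ z₁ → Σ-zero F.elements (All.universal
            (λ z₂ → ℤP.*-zeroˡ (slopeIncidence m₂ (y₁ F.- z₁) (y₂ F.- z₂))) F.elements)) F.elements))
          (vanish (finite m₂) ⟦ nothing ≟M m₂ ⟧ q)
    where
    vanish : ∀ a b q → 0ℤ ≡ 0ℤ * a + b * (q * 0ℤ - 0ℤ)
    vanish = solve-∀
  Σ-two-lines (just c) nothing x₁ x₂ y₁ y₂ =
    trans (Σ-zero F.elements (All.universal (λ z₁ → Σ-zero F.elements (All.universal
            (λ z₂ → ℤP.*-zeroʳ (slopeIncidence (just c) (z₁ F.- x₁) (z₂ F.- x₂))) F.elements)) F.elements))
          (vanish ⟦ just c ≟M nothing ⟧ (⟦⟧-no (just c ≟M nothing) (λ ())) (q * slopeIncidence (just c) (y₁ F.- x₁) (y₂ F.- x₂) - 1ℤ))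
    where
    vanish : ∀ i → i ≡ 0ℤ → ∀ a → 0ℤ ≡ 1ℤ * 0ℤ + i * a
    vanish i refl a = sym (ℤP.*-zeroˡ a)
  Σ-two-lines (just c) (just c') x₁ x₂ y₁ y₂ =
    trans (Σ-cong F.elements (λ z₁ → Σ-on-line c x₁ x₂ z₁ (λ z₂ → slopeIncidence (just c') (y₁ F.- z₁) (y₂ F.- z₂))))
          (meet (c F.≟ c'))
    where
    ℓ : F.Carrier → F.Carrier
    ℓ = F.line x₁ x₂ c
    n₀ : ℤ
    n₀ = slopeIncidence (just c) (y₁ F.- x₁) (y₂ F.- x₂)
    same-line : ∀ z₁ → (y₂ F.- ℓ z₁ ≡ c F.* (y₁ F.- z₁)) → (y₂ F.- x₂ ≡ c F.* (y₁ F.- x₁))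
    same-line z₁ = F.≡-by-multiple F.1#
      (F.solve 6 (λ y₂ x₂ c y₁ x₁ z₁ → (y₂ F.:- x₂) F.:- c F.:* (y₁ F.:- x₁)
                   F.:= F.con (ℤ.+ 1) F.:* ((y₂ F.:- (x₂ F.:+ c F.:* (z₁ F.:- x₁))) F.:- c F.:* (y₁ F.:- z₁))) refl y₂ x₂ c y₁ x₁ z₁)
    same-line⁻¹ : ∀ z₁ → (y₂ F.- x₂ ≡ c F.* (y₁ F.- x₁)) → (y₂ F.- ℓ z₁ ≡ c F.* (y₁ F.- z₁))
    same-line⁻¹ z₁ = F.≡-by-multiple F.1#
      (F.solve 6 (λ y₂ x₂ c y₁ x₁ z₁ → (y₂ F.:- (x₂ F.:+ c F.:* (z₁ F.:- x₁))) F.:- c F.:* (y₁ F.:- z₁)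
                   F.:= F.con (ℤ.+ 1) F.:* ((y₂ F.:- x₂) F.:- c F.:* (y₁ F.:- x₁))) refl y₂ x₂ c y₁ x₁ z₁)
    meet : Dec (c ≡ c') → Σ-list F.elements (λ z₁ → slopeIncidence (just c') (y₁ F.- z₁) (y₂ F.- ℓ z₁))
                          ≡ 1ℤ * 1ℤ + ⟦ just c ≟M just c' ⟧ * (q * n₀ - 1ℤ)
    meet (yes refl) =
      begin
        Σ-list F.elements (λ z₁ → ⟦ (y₂ F.- ℓ z₁) F.≟ (c F.* (y₁ F.- z₁)) ⟧)
      ≡⟨ Σ-cong F.elements (λ z₁ → ⟦⟧-iff ((y₂ F.- ℓ z₁) F.≟ (c F.* (y₁ F.- z₁))) ((y₂ F.- x₂) F.≟ (c F.* (y₁ F.- x₁)))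
                                            (same-line z₁) (same-line⁻¹ z₁)) ⟩
        Σ-list F.elements (λ _ → n₀)
      ≡⟨ ΣF.Σ-elements-const n₀ ⟩
        q * n₀
      ≡⟨ rearrange q n₀ ⟩
        1ℤ * 1ℤ + 1ℤ * (q * n₀ - 1ℤ)
      ≡⟨ cong (λ i → 1ℤ * 1ℤ + i * (q * n₀ - 1ℤ)) (sym (⟦⟧-yes (just c ≟M just c) refl)) ⟩
        1ℤ * 1ℤ + ⟦ just c ≟M just c ⟧ * (q * n₀ - 1ℤ)
      ∎
      where
      open ≡-Reasoning
      rearrange : ∀ q n → q * n ≡ 1ℤ * 1ℤ + 1ℤ * (q * n - 1ℤ)
      rearrange = solve-∀
    meet (no c≢c') =
      trans (ΣF.Σ-elements-count (F.solution (c F.- c') c-c'≢0 K) (λ z₁ → (y₂ F.- ℓ z₁) F.≟ (c' F.* (y₁ F.- z₁)))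
                                 (λ z₁ e → F.solution-unique (c F.- c') c-c'≢0 z₁ (sym (F.≡-by-multiple F.1# (to z₁) e)))
                                 (F.≡-by-multiple F.1# (from _) (sym (F.solution-correct (c F.- c') c-c'≢0 K))))
            (cong (λ i → 1ℤ * 1ℤ + i * (q * n₀ - 1ℤ)) (sym (⟦⟧-no (just c ≟M just c') (λ e → c≢c' (MaybeP.just-injective e)))))
      where
      -- the two lines meet where (c - c') z₁ = K
      K : F.Carrier
      K = y₂ F.- x₂ F.+ c F.* x₁ F.- c' F.* y₁
      c-c'≢0 : F.NonZero (c F.- c')
      c-c'≢0 e = c≢c' (F.x-y≡0⇒x≡y c c' e)
      to : ∀ z₁ → K F.- (c F.- c') F.* z₁ ≡ F.1# F.* ((y₂ F.- ℓ z₁) F.- c' F.* (y₁ F.- z₁))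
      to z₁ = F.solve 7 (λ y₂ x₂ c x₁ c' y₁ z₁ → (y₂ F.:- x₂ F.:+ c F.:* x₁ F.:- c' F.:* y₁) F.:- (c F.:- c') F.:* z₁
                F.:= F.con (ℤ.+ 1) F.:* ((y₂ F.:- (x₂ F.:+ c F.:* (z₁ F.:- x₁))) F.:- c' F.:* (y₁ F.:- z₁))) refl y₂ x₂ c x₁ c' y₁ z₁
      from : ∀ z₁ → (y₂ F.- ℓ z₁) F.- c' F.* (y₁ F.- z₁) ≡ F.1# F.* (K F.- (c F.- c') F.* z₁)
      from z₁ = F.solve 7 (λ y₂ x₂ c x₁ c' y₁ z₁ → (y₂ F.:- (x₂ F.:+ c F.:* (z₁ F.:- x₁))) F.:- c' F.:* (y₁ F.:- z₁)
                  F.:= F.con (ℤ.+ 1) F.:* ((y₂ F.:- x₂ F.:+ c F.:* x₁ F.:- c' F.:* y₁) F.:- (c F.:- c') F.:* z₁)) refl y₂ x₂ c x₁ c' y₁ z₁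

  -- (J - I)² on 𝔽_{q+1}, in difference form
  offDiagonal² : G.Carrier → ℤ
  offDiagonal² d = (- 1ℤ * - 1ℤ) * δG d + (- 1ℤ * 1ℤ + 1ℤ * - 1ℤ + g * 1ℤ * 1ℤ)

  finite-slope : ∀ β b b' → G.NonZero β → finite (φ→ (β G.* (b' G.- b))) ≡ IJ TG (- 1ℤ) 1ℤ b b'
  finite-slope β b b' β≢0 =
    trans (finite-φ β (b' G.- b) β≢0) (trans (cong (λ i → 1ℤ - i) (sym (δG-diff b b'))) (J-I-form ⟦ b G.≟ b' ⟧))
    where
    J-I-form : ∀ x → 1ℤ - x ≡ - 1ℤ * x + 1ℤ
    J-I-form = solve-∀

  -- N_β N_γ: the middle point b' on 𝔽_{q+1} contributes one common point of
  -- two lines when the slopes differ, and q or 0 points when they agree.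
  N-N-product : ∀ β γ → G.NonZero β → G.NonZero γ → ∀ b x₁ x₂ b'' y₁ y₂ →
    mul TX (N β) (N γ) (b , x₁ , x₂) (b'' , y₁ , y₂) ≡
    offDiagonal² (b'' G.- b) + Σ-list G.elements (λ b' → ⟦ (β G.* (b' G.- b)) G.≟ (γ G.* (b'' G.- b')) ⟧ *
      (q * slopeIncidence (φ→ (β G.* (b' G.- b))) (y₁ F.- x₁) (y₂ F.- x₂) - finite (φ→ (β G.* (b' G.- b)))))
  N-N-product β γ β≢0 γ≢0 b x₁ x₂ b'' y₁ y₂ =
    begin
      mul TX (N β) (N γ) x y
    ≡⟨ mul-ΣPt (N β) (N γ) x y ⟩
      ΣPt (λ z → N β x z * N γ z y)
    ≡⟨ Σ-cong G.elements (λ b' → trans (Σ-cong F.elements (λ z₁ → Σ-cong F.elements (λ z₂ →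
                                          cong₂ _*_ (N-diff β b x₁ x₂ b' z₁ z₂) (N-diff γ b' z₁ z₂ b'' y₁ y₂))))
                                  (trans (Σ-two-lines (m₁ b') (m₂ b') x₁ x₂ y₁ y₂)
                                         (cong (λ i → finite (m₁ b') * finite (m₂ b') + i * H b') (same-slope b')))) ⟩
      Σ-list G.elements (λ b' → finite (m₁ b') * finite (m₂ b') + I b' * H b')
    ≡⟨ Σ-+ G.elements (λ b' → finite (m₁ b') * finite (m₂ b')) (λ b' → I b' * H b') ⟩
      Σ-list G.elements (λ b' → finite (m₁ b') * finite (m₂ b')) + Σ-list G.elements (λ b' → I b' * H b')
    ≡⟨ cong (_+ Σ-list G.elements (λ b' → I b' * H b')) both-finite ⟩
      offDiagonal² (b'' G.- b) + Σ-list G.elements (λ b' → I b' * H b')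
    ∎
    where
    open ≡-Reasoning
    x y : Pt
    x = (b , x₁ , x₂)
    y = (b'' , y₁ , y₂)
    m₁ m₂ : G.Carrier → Maybe F.Carrier
    m₁ b' = φ→ (β G.* (b' G.- b))
    m₂ b' = φ→ (γ G.* (b'' G.- b'))
    H I : G.Carrier → ℤ
    H b' = q * slopeIncidence (m₁ b') (y₁ F.- x₁) (y₂ F.- x₂) - finite (m₁ b')
    I b' = ⟦ (β G.* (b' G.- b)) G.≟ (γ G.* (b'' G.- b')) ⟧
    same-slope : ∀ b' → ⟦ m₁ b' ≟M m₂ b' ⟧ ≡ I b'
    same-slope b' = ⟦⟧-iff (m₁ b' ≟M m₂ b') ((β G.* (b' G.- b)) G.≟ (γ G.* (b'' G.- b'))) φ-injective (cong φ→)
    both-finite : Σ-list G.elements (λ b' → finite (m₁ b') * finite (m₂ b')) ≡ offDiagonal² (b'' G.- b)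
    both-finite =
      begin
        Σ-list G.elements (λ b' → finite (m₁ b') * finite (m₂ b'))
      ≡⟨ Σ-cong G.elements (λ b' → cong₂ _*_ (finite-slope β b b' β≢0) (finite-slope γ b' b'' γ≢0)) ⟩
        mul TG (IJ TG (- 1ℤ) 1ℤ) (IJ TG (- 1ℤ) 1ℤ) b b''
      ≡⟨ IJ-mul TG G.elements-unique G.elements-complete (- 1ℤ) 1ℤ (- 1ℤ) 1ℤ b b'' ⟩
        (- 1ℤ * - 1ℤ) * ⟦ b G.≟ b'' ⟧ + (- 1ℤ * 1ℤ + 1ℤ * - 1ℤ + g * 1ℤ * 1ℤ)
      ≡⟨ cong (λ i → (- 1ℤ * - 1ℤ) * i + (- 1ℤ * 1ℤ + 1ℤ * - 1ℤ + g * 1ℤ * 1ℤ)) (δG-diff b b'') ⟩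
        offDiagonal² (b'' G.- b)
      ∎

  -- For β + γ ≠ 0 the equation β (b' - b) = γ (b'' - b') has the single
  -- solution b' = (β b + γ b'') / (β + γ), where the common slope is
  -- δ (b'' - b) with δ = β γ / (β + γ).
  combinedSlope : ∀ β γ → G.NonZero (β G.+ γ) → G.Carrier
  combinedSlope β γ s≢0 = β G.* γ G.* ((β G.+ γ) G.⁻¹) s≢0

  combinedSlope-nonZero : ∀ β γ → G.NonZero β → G.NonZero γ → (s≢0 : G.NonZero (β G.+ γ)) →
                          G.NonZero (combinedSlope β γ s≢0)
  combinedSlope-nonZero β γ β≢0 γ≢0 s≢0 = G.*-nonZero (G.*-nonZero β≢0 γ≢0) (G.⁻¹-nonZero (β G.+ γ) s≢0)

  N-N-generic : ∀ β γ → G.NonZero β → G.NonZero γ → (s≢0 : G.NonZero (β G.+ γ)) → ∀ x y → let u = diff x y in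
    mul TX (N β) (N γ) x y ≡ offDiagonal² (proj₁ u) + (q * Ñ (combinedSlope β γ s≢0) u - (1ℤ - δG (proj₁ u)))
  N-N-generic β γ β≢0 γ≢0 s≢0 (b , x₁ , x₂) (b'' , y₁ , y₂) =
    trans (N-N-product β γ β≢0 γ≢0 b x₁ x₂ b'' y₁ y₂)
      (cong (offDiagonal² (b'' G.- b) +_)
        (trans (ΣG.Σ-elements-select t (λ b' → (β G.* (b' G.- b)) G.≟ (γ G.* (b'' G.- b'))) only on-both H)
               (trans (cong (λ w → q * slopeIncidence (φ→ w) (y₁ F.- x₁) (y₂ F.- x₂) - finite (φ→ w)) slope-at-t)
                      (cong (λ f → q * slopeIncidence (φ→ (δ G.* (b'' G.- b))) (y₁ F.- x₁) (y₂ F.- x₂) - f)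
                            (finite-φ δ (b'' G.- b) (combinedSlope-nonZero β γ β≢0 γ≢0 s≢0))))))
    where
    s W δ t : G.Carrier
    s = β G.+ γ
    W = β G.* b G.+ γ G.* b''
    δ = combinedSlope β γ s≢0
    t = G.solution s s≢0 W
    H : G.Carrier → ℤ
    H b' = q * slopeIncidence (φ→ (β G.* (b' G.- b))) (y₁ F.- x₁) (y₂ F.- x₂) - finite (φ→ (β G.* (b' G.- b)))
    to : ∀ b' → s G.* b' G.- W ≡ G.1# G.* (β G.* (b' G.- b) G.- γ G.* (b'' G.- b'))
    to b' = G.solve 5 (λ β γ b b'' b' → (β G.:+ γ) G.:* b' G.:- (β G.:* b G.:+ γ G.:* b'')
                        G.:= G.con (ℤ.+ 1) G.:* (β G.:* (b' G.:- b) G.:- γ G.:* (b'' G.:- b'))) refl β γ b b'' b'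
    from : ∀ b' → β G.* (b' G.- b) G.- γ G.* (b'' G.- b') ≡ G.1# G.* (s G.* b' G.- W)
    from b' = G.solve 5 (λ β γ b b'' b' → β G.:* (b' G.:- b) G.:- γ G.:* (b'' G.:- b')
                          G.:= G.con (ℤ.+ 1) G.:* ((β G.:+ γ) G.:* b' G.:- (β G.:* b G.:+ γ G.:* b''))) refl β γ b b'' b'
    only : ∀ b' → β G.* (b' G.- b) ≡ γ G.* (b'' G.- b') → b' ≡ t
    only b' e = G.solution-unique s s≢0 b' (G.≡-by-multiple G.1# (to b') e)
    on-both : β G.* (t G.- b) ≡ γ G.* (b'' G.- t)
    on-both = G.≡-by-multiple G.1# (from t) (G.solution-correct s s≢0 W)
    slope-at-t : β G.* (t G.- b) ≡ δ G.* (b'' G.- b)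
    slope-at-t =
      begin
        β G.* (t G.- b)
      ≡⟨ G.solve 5 (λ β γ b b'' i → β G.:* ((β G.:* b G.:+ γ G.:* b'') G.:* i G.:- b)
                      G.:= (β G.:* γ G.:* i) G.:* (b'' G.:- b) G.:+ β G.:* b G.:* ((β G.:+ γ) G.:* i G.:- G.con (ℤ.+ 1)))
                  refl β γ b b'' ((s G.⁻¹) s≢0) ⟩
        δ G.* (b'' G.- b) G.+ β G.* b G.* (s G.* (s G.⁻¹) s≢0 G.- G.1#)
      ≡⟨ cong (λ e → δ G.* (b'' G.- b) G.+ β G.* b G.* (e G.- G.1#)) (G.*-inverseʳ s s≢0) ⟩
        δ G.* (b'' G.- b) G.+ β G.* b G.* (G.1# G.- G.1#)
      ≡⟨ G.solve 3 (λ z β b → z G.:+ β G.:* b G.:* (G.con (ℤ.+ 1) G.:- G.con (ℤ.+ 1)) G.:= z) refl (δ G.* (b'' G.- b)) β b ⟩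
        δ G.* (b'' G.- b)
      ∎
      where open ≡-Reasoning

  -- For β + γ = 0 the equation β (b' - b) = γ (b'' - b') says b = b''.
  N-N-opposite : ∀ β γ → G.NonZero β → G.NonZero γ → β G.+ γ ≡ G.0# → ∀ x y → let (d , e₁ , e₂) = diff x y in
    mul TX (N β) (N γ) x y ≡ offDiagonal² d + δG d * (q * lineCount e₁ e₂ - q)
  N-N-opposite β γ β≢0 γ≢0 s≡0 (b , x₁ , x₂) (b'' , y₁ , y₂) =
    trans (N-N-product β γ β≢0 γ≢0 b x₁ x₂ b'' y₁ y₂)
      (cong (offDiagonal² (b'' G.- b) +_)
        (trans (Σ-cong G.elements (λ b' → cong (_* H b') (⟦⟧-iff ((β G.* (b' G.- b)) G.≟ (γ G.* (b'' G.- b'))) (b G.≟ b'') (to b') (from b'))))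
          (trans (Σ-*ˡ G.elements ⟦ b G.≟ b'' ⟧ H)
            (cong₂ _*_ (δG-diff b b'') ΣH))))
    where
    e₁ e₂ : F.Carrier
    e₁ = y₁ F.- x₁
    e₂ = y₂ F.- x₂
    H : G.Carrier → ℤ
    H b' = q * slopeIncidence (φ→ (β G.* (b' G.- b))) e₁ e₂ - finite (φ→ (β G.* (b' G.- b)))
    difference : ∀ b' → β G.* (b' G.- b) G.- γ G.* (b'' G.- b') ≡ β G.* (b'' G.- b)
    difference b' =
      trans (G.solve 5 (λ β γ b b'' b' → β G.:* (b' G.:- b) G.:- γ G.:* (b'' G.:- b')
                          G.:= β G.:* (b'' G.:- b) G.:- (β G.:+ γ) G.:* (b'' G.:- b')) refl β γ b b'' b')
            (trans (cong (λ z → β G.* (b'' G.- b) G.- z G.* (b'' G.- b')) s≡0)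
                   (G.solve 2 (λ z w → z G.:- G.con (ℤ.+ 0) G.:* w G.:= z) refl (β G.* (b'' G.- b)) (b'' G.- b')))
    to : ∀ b' → β G.* (b' G.- b) ≡ γ G.* (b'' G.- b') → b ≡ b''
    to b' e = sym (G.x-y≡0⇒x≡y b'' b (G.*-cancel-≡0 β β≢0 (trans (sym (difference b')) (G.x≡y⇒x-y≡0 e))))
    from : ∀ b' → b ≡ b'' → β G.* (b' G.- b) ≡ γ G.* (b'' G.- b')
    from b' e = G.x-y≡0⇒x≡y _ _ (trans (difference b') (trans (cong (β G.*_) (G.x≡y⇒x-y≡0 (sym e))) (G.*-zeroʳ β)))
    ΣH : Σ-list G.elements H ≡ q * lineCount e₁ e₂ - q
    ΣH =
      begin
        Σ-list G.elements H
      ≡⟨ Σ-slopes-affine β b β≢0 (λ m → q * slopeIncidence m e₁ e₂ - finite m) ⟩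
        q * 0ℤ - 0ℤ + Σ-list F.elements (λ s → q * ⟦ e₂ F.≟ (s F.* e₁) ⟧ - 1ℤ)
      ≡⟨ cong (q * 0ℤ - 0ℤ +_) (trans (Σ-- F.elements (λ s → q * ⟦ e₂ F.≟ (s F.* e₁) ⟧) (λ _ → 1ℤ))
            (cong₂ _-_ (trans (Σ-*ˡ F.elements q (λ s → ⟦ e₂ F.≟ (s F.* e₁) ⟧)) (cong (q *_) (ΣF.Σ-slopes e₁ e₂)))
                       (ΣF.Σ-elements-const 1ℤ))) ⟩
        q * 0ℤ - 0ℤ + (q * lineCount e₁ e₂ - q * 1ℤ)
      ≡⟨ simplify q (lineCount e₁ e₂) ⟩
        q * lineCount e₁ e₂ - q
      ∎
      where
      open ≡-Reasoning
      simplify : ∀ q L → q * 0ℤ - 0ℤ + (q * L - q * 1ℤ) ≡ q * L - q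
      simplify = solve-∀

  -- A_{5,β} A_{5,γ} = (N_β - A₃)(N_γ - A₃), where A₃ N_γ = N_γ A₃
  A₅-A₅-split : ∀ β γ x y → mul TX (A₅ β) (A₅ γ) x y ≡
    mul TX (N β) (N γ) x y - mul TX (N β) A₃ x y - (mul TX (N γ) A₃ x y - mul TX A₃ A₃ x y)
  A₅-A₅-split β γ x y =
    trans (mul-distribʳ-- TX (N β) A₃ (A₅ γ) x y)
      (cong₂ _-_ (mul-distribˡ-- TX (N β) (N γ) A₃ x y)
                 (trans (mul-distribˡ-- TX A₃ (N γ) A₃ x y)
                        (cong (_- mul TX A₃ A₃ x y) (difference-commute A₃ (N γ) (A-difference c3) (N-difference γ) x y))))

  N-A₃ : ∀ β → G.NonZero β → ∀ x y → mul TX (N β) A₃ x y ≡ N-Kron-corners σ₃ · vanishing (diff x y) + - 1ℤ * X β (diff x y)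
  N-A₃ β β≢0 x y =
    trans (mul-cong TX {N β} {N β} (λ _ _ → refl) (A-Kron kc3) x y)
          (trans (N-Kron-product β β≢0 σ₃ refl x y) (N-Kron-span σ₃ β (diff x y)))

  A₃-A₃ : ∀ x y → mul TX A₃ A₃ x y ≡ shapeCorners (σ₃ ∙ σ₃) · vanishing (diff x y)
  A₃-A₃ x y =
    trans (mul-cong TX (A-Kron kc3) (A-Kron kc3) x y) (trans (Kron-mul σ₃ σ₃ x y) (Kron-span (σ₃ ∙ σ₃) (∙-admissible σ₃ σ₃ refl refl) x y))

  A₅-A₅-corners : Kron6 → Kron6
  A₅-A₅-corners κ = κ ⊟ N-Kron-corners σ₃ ⊟ N-Kron-corners σ₃ ⊞ shapeCorners (σ₃ ∙ σ₃)

  A₅-A₅-from-N-N : ∀ β γ → G.NonZero β → G.NonZero γ → ∀ κ ws x y → let u = diff x y in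
    mul TX (N β) (N γ) x y ≡ κ · vanishing u + Σ-list ws (λ w → proj₁ w * X (proj₂ w) u) →
    mul TX (A₅ β) (A₅ γ) x y ≡ A₅-A₅-corners κ · vanishing u
                               + Σ-list ((1ℤ , β) ∷ (1ℤ , γ) ∷ ws) (λ w → proj₁ w * X (proj₂ w) u)
  A₅-A₅-from-N-N β γ β≢0 γ≢0 κ ws x y N-N =
    begin
      mul TX (A₅ β) (A₅ γ) x y
    ≡⟨ A₅-A₅-split β γ x y ⟩
      mul TX (N β) (N γ) x y - mul TX (N β) A₃ x y - (mul TX (N γ) A₃ x y - mul TX A₃ A₃ x y)
    ≡⟨ cong₂ _-_ (cong₂ _-_ N-N (N-A₃ β β≢0 x y)) (cong₂ _-_ (N-A₃ γ γ≢0 x y) (A₃-A₃ x y)) ⟩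
      κ · v + V - (S · v + - 1ℤ * X β u) - ((S · v + - 1ℤ * X γ u) - T · v)
    ≡⟨ regroup (κ · v) (S · v) (T · v) V (X β u) (X γ u) ⟩
      κ · v - S · v - S · v + T · v + (1ℤ * X β u + (1ℤ * X γ u + V))
    ≡⟨ cong (_+ (1ℤ * X β u + (1ℤ * X γ u + V)))
            (sym (trans (·-⊞ (κ ⊟ S ⊟ S) T v) (cong (_+ T · v) (trans (·-⊟ (κ ⊟ S) S v) (cong (_- S · v) (·-⊟ κ S v)))))) ⟩
      (κ ⊟ S ⊟ S ⊞ T) · v + (1ℤ * X β u + (1ℤ * X γ u + V))
    ∎
    where
    open ≡-Reasoning
    u : Diff
    u = diff x y
    v S T : Kron6
    v = vanishing u
    S = N-Kron-corners σ₃
    T = shapeCorners (σ₃ ∙ σ₃)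
    V : ℤ
    V = Σ-list ws (λ w → proj₁ w * X (proj₂ w) u)
    regroup : ∀ K S T V Xβ Xγ → K + V - (S + - 1ℤ * Xβ) - ((S + - 1ℤ * Xγ) - T) ≡ K - S - S + T + (1ℤ * Xβ + (1ℤ * Xγ + V))
    regroup = solve-∀

  κ-generic κ-opposite : Kron6
  κ-generic = ⟨ g - 1ℤ , g - 1ℤ , g - 1ℤ , g + q - ℤ.+ 3 , g - ℤ.+ 3 , g - ℤ.+ 3 ⟩
  κ-opposite = ⟨ g - 1ℤ - q + q * q , g - 1ℤ - q , g - 1ℤ , g - ℤ.+ 2 , g - ℤ.+ 2 , g - ℤ.+ 2 ⟩

  A₅-A₅-closed : ∀ β p γ p' → Closed (c5 β p) (c5 γ p')
  A₅-A₅-closed β p γ p' with (β G.+ γ) G.≟ G.0#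
  ... | no s≢0 =
    closed-by (c5 β p) (c5 γ p') (A₅-A₅-corners κ-generic) ((1ℤ , β) ∷ (1ℤ , γ) ∷ (q , δ) ∷ [])
              (β≢0 ∷ γ≢0 ∷ combinedSlope-nonZero β γ β≢0 γ≢0 s≢0 ∷ [])
              (λ x y → A₅-A₅-from-N-N β γ β≢0 γ≢0 κ-generic ((q , δ) ∷ []) x y
                         (trans (N-N-generic β γ β≢0 γ≢0 s≢0 x y) (expand (diff x y))))
    where
    β≢0 : G.NonZero β
    β≢0 = nonZero-of β p
    γ≢0 : G.NonZero γ
    γ≢0 = nonZero-of γ p'
    δ : G.Carrier
    δ = combinedSlope β γ s≢0
    expand : ∀ u → offDiagonal² (proj₁ u) + (q * Ñ δ u - (1ℤ - δG (proj₁ u))) ≡ κ-generic · vanishing u + (q * X δ u + 0ℤ)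
    expand u@(d , e₁ , e₂) = polynomial g q (δG d) (δF e₁) (δF e₂) (Ñ δ u)
      where
      polynomial : ∀ g q D E₁ E₂ N → (- 1ℤ * - 1ℤ) * D + (- 1ℤ * 1ℤ + 1ℤ * - 1ℤ + g * 1ℤ * 1ℤ) + (q * N - (1ℤ - D)) ≡
        (g - 1ℤ) * (D * (E₁ * E₂)) + (g - 1ℤ) * (D * (E₁ * (1ℤ - E₂))) + (g - 1ℤ) * (D * ((1ℤ - E₁) * 1ℤ))
        + (g + q - ℤ.+ 3) * ((1ℤ - D) * (E₁ * E₂)) + (g - ℤ.+ 3) * ((1ℤ - D) * (E₁ * (1ℤ - E₂)))
        + (g - ℤ.+ 3) * ((1ℤ - D) * (1ℤ - E₁)) + (q * (N - (1ℤ - D) * (E₁ * E₂)) + 0ℤ)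
      polynomial = solve-∀
  ... | yes s≡0 =
    closed-by (c5 β p) (c5 γ p') (A₅-A₅-corners κ-opposite) ((1ℤ , β) ∷ (1ℤ , γ) ∷ []) (β≢0 ∷ γ≢0 ∷ [])
              (λ x y → A₅-A₅-from-N-N β γ β≢0 γ≢0 κ-opposite [] x y
                         (trans (N-N-opposite β γ β≢0 γ≢0 s≡0 x y) (expand (diff x y))))
    where
    β≢0 : G.NonZero β
    β≢0 = nonZero-of β p
    γ≢0 : G.NonZero γ
    γ≢0 = nonZero-of γ p'
    expand : ∀ u → let (d , e₁ , e₂) = u in offDiagonal² d + δG d * (q * lineCount e₁ e₂ - q) ≡ κ-opposite · vanishing u + 0ℤ
    expand (d , e₁ , e₂) = polynomial g q (δG d) (δF e₁) (δF e₂)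
      where
      polynomial : ∀ g q D E₁ E₂ → (- 1ℤ * - 1ℤ) * D + (- 1ℤ * 1ℤ + 1ℤ * - 1ℤ + g * 1ℤ * 1ℤ) + D * (q * (1ℤ - E₁ + q * (E₁ * E₂)) - q) ≡
        (g - 1ℤ - q + q * q) * (D * (E₁ * E₂)) + (g - 1ℤ - q) * (D * (E₁ * (1ℤ - E₂))) + (g - 1ℤ) * (D * ((1ℤ - E₁) * 1ℤ))
        + (g - ℤ.+ 2) * ((1ℤ - D) * (E₁ * E₂)) + (g - ℤ.+ 2) * ((1ℤ - D) * (E₁ * (1ℤ - E₂)))
        + (g - ℤ.+ 2) * ((1ℤ - D) * (1ℤ - E₁)) + 0ℤ
      polynomial = solve-∀

  data ClassView : Cls → Set where
    kron : ∀ k → ClassView (cls k)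
    a₅ : ∀ β p → ClassView (c5 β p)

  view : ∀ i → ClassView i
  view c0 = kron kc0
  view c1 = kron kc1
  view c2 = kron kc2
  view c3 = kron kc3
  view c4 = kron kc4
  view (c5 β p) = a₅ β p

  closed-flip : ∀ i j → Closed i j → Closed j i
  closed-flip i j (c , product) = c , λ x y → trans (commute j i x y) (product x y)

  closed : ∀ i j → Closed i j
  closed i j with view i | view j
  ... | kron k | kron k' = Kron-closed k k'
  ... | a₅ β p | kron k = A₅-Kron-closed β p k
  ... | kron k | a₅ β p = closed-flip (c5 β p) (cls k) (A₅-Kron-closed β p k)
  ... | a₅ β p | a₅ γ p' = A₅-A₅-closed β p γ p'

  -- nz β lists the class A_{5,β} when β ≠ 0.  (These facts are phrased
  -- through the index of a class, since nz is defined by a case split on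
  -- β ≟ 0, which also occurs in the type of the proof carried by c5.)
  index : Cls → G.Carrier
  index (c5 β _) = β
  index _ = G.0#

  IsA₅ : Cls → Set
  IsA₅ k = Σ G.Carrier λ γ → Σ (False (γ G.≟ G.0#)) λ p → k ≡ c5 γ p

  nz-A₅ : ∀ β → G.NonZero β → Any (λ k → index k ≡ β × IsA₅ k) (nz β)
  nz-A₅ β β≢0 with β G.≟ G.0#
  ... | yes β≡0 = ⊥-elim (β≢0 β≡0)
  ... | no _ = here (refl , β , _ , refl)

  nz-All : ∀ {P : Cls → Set} β → (∀ k → IsA₅ k → index k ≡ β → P k) → All P (nz β)
  nz-All β h with β G.≟ G.0#
  ... | yes _ = []
  ... | no _ = h _ (β , _ , refl) refl ∷ []

  ∈-nz : ∀ β p → c5 β p ∈ nz β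
  ∈-nz β p = Any.map (λ { (refl , γ , p' , refl) → cong (c5 γ) (T-irrelevant p p') }) (nz-A₅ β (nonZero-of β p))

  All-A₅ : ∀ {P : Cls → Set} xs → All (λ β → ∀ p → P (c5 β p)) xs → All P (concatMap nz xs)
  All-A₅ [] [] = []
  All-A₅ {P} (β ∷ xs) (h ∷ hs) = AllP.++⁺ (nz-All β (λ { _ (γ , p , refl) refl → h p })) (All-A₅ xs hs)

  ∈-A₅ : ∀ β p xs → β ∈ xs → c5 β p ∈ concatMap nz xs
  ∈-A₅ β p (x ∷ xs) (here refl) = ∈-++⁺ˡ (∈-nz β p)
  ∈-A₅ β p (x ∷ xs) (there β∈xs) = ∈-++⁺ʳ (nz x) (∈-A₅ β p xs β∈xs)

  classes-complete : ∀ i → i ∈ classes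
  classes-complete c0 = here refl
  classes-complete c1 = there (here refl)
  classes-complete c2 = there (there (here refl))
  classes-complete c3 = there (there (there (here refl)))
  classes-complete c4 = there (there (there (there (here refl))))
  classes-complete (c5 β p) = there (there (there (there (there (∈-A₅ β p G.elements (G.elements-complete β))))))

  A₅-unique : ∀ xs → Unique xs → Unique (concatMap nz xs)
  A₅-unique [] [] = []
  A₅-unique (β ∷ xs) (β∉xs ∷ u) with β G.≟ G.0#
  ... | yes _ = A₅-unique xs u
  ... | no _ = All-A₅ xs (All.map (λ β≢γ p → λ { refl → β≢γ refl }) β∉xs) ∷ A₅-unique xs u

  classes-unique : Unique classes
  classes-unique =
    ((λ ()) ∷ (λ ()) ∷ (λ ()) ∷ (λ ()) ∷ not-A₅ (λ _ _ ())) ∷ ((λ ()) ∷ (λ ()) ∷ (λ ()) ∷ not-A₅ (λ _ _ ())) ∷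
    ((λ ()) ∷ (λ ()) ∷ not-A₅ (λ _ _ ())) ∷ ((λ ()) ∷ not-A₅ (λ _ _ ())) ∷ not-A₅ (λ _ _ ()) ∷
    A₅-unique G.elements G.elements-unique
    where
    not-A₅ : ∀ {k} → (∀ β p → ¬ k ≡ c5 β p) → All (λ k' → ¬ k ≡ k') (concatMap nz G.elements)
    not-A₅ k∉A₅ = All-A₅ G.elements (All.universal k∉A₅ G.elements)

  #A₅ : length (concatMap nz G.elements) ≡ F.order
  #A₅ = ℤP.+-injective (
    begin
      ℤ.+ length (concatMap nz G.elements)
    ≡⟨ sym (ℤP.*-identityʳ _) ⟩
      ℤ.+ length (concatMap nz G.elements) * 1ℤ
    ≡⟨ sym (Σ-const (concatMap nz G.elements) 1ℤ) ⟩
      Σ-list (concatMap nz G.elements) (λ _ → 1ℤ)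
    ≡⟨ Σ-A₅-classes (λ _ → 1ℤ) (λ _ → 1ℤ) (λ _ _ → refl) ⟩
      Σ-list G.elements (λ β → (1ℤ - δG β) * 1ℤ)
    ≡⟨ trans (Σ-cong G.elements (λ β → split (δG β))) (Σ-- G.elements (λ _ → 1ℤ) δG) ⟩
      Σ-list G.elements (λ _ → 1ℤ) - Σ-list G.elements δG
    ≡⟨ cong₂ _-_ (ΣG.Σ-elements-const 1ℤ) (ΣG.Σ-elements-count G.0# (λ β → β G.≟ G.0#) (λ _ e → e) refl) ⟩
      g * 1ℤ - 1ℤ
    ≡⟨ cong (λ h → h * 1ℤ - 1ℤ) g≡1+q ⟩
      (1ℤ + q) * 1ℤ - 1ℤ
    ≡⟨ simplify q ⟩
      q
    ∎)
    where
    open ≡-Reasoning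
    split : ∀ D → (1ℤ - D) * 1ℤ ≡ 1ℤ - D
    split = solve-∀
    simplify : ∀ q → (1ℤ + q) * 1ℤ - 1ℤ ≡ q
    simplify = solve-∀

  #classes : length classes ≡ suc (F.order ℕ.+ 4)
  #classes = trans (cong (λ n → suc (suc (suc (suc (suc n))))) #A₅) (cong suc (ℕP.+-comm 4 F.order))

  zeroOne-A₅ : ∀ β → G.NonZero β → ∀ u → ZeroOne (X β u)
  zeroOne-A₅ β β≢0 (d , e₁ , e₂) with d G.≟ G.0#
  ... | yes refl = inj₁ (trans (cong (λ m → slopeIncidence m e₁ e₂ - 0ℤ * (δF e₁ * δF e₂)) (φ-at-0 (G.*-zeroʳ β)))
                              (cong (λ i → 0ℤ - i) (ℤP.*-zeroˡ (δF e₁ * δF e₂))))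
  ... | no d≢0 with φ→ (β G.* d) in eq
  ...   | nothing = ⊥-elim (G.*-nonZero β≢0 d≢0 (φ-injective (trans eq (sym φ-0))))
  ...   | just c = off-origin (e₁ F.≟ F.0#) (e₂ F.≟ F.0#)
    where
    -- away from b' = b, A_{5,β} is N_β with the diagonal point removed
    off-origin : Dec (e₁ ≡ F.0#) → Dec (e₂ ≡ F.0#) → ZeroOne (⟦ e₂ F.≟ (c F.* e₁) ⟧ - (1ℤ - 0ℤ) * (δF e₁ * δF e₂))
    off-origin (yes refl) (yes refl) =
      inj₁ (trans (cong₂ (λ n i → n - (1ℤ - 0ℤ) * i)
                         (⟦⟧-yes (F.0# F.≟ (c F.* F.0#)) (sym (F.*-zeroʳ c)))
                         (cong₂ _*_ (⟦⟧-yes (F.0# F.≟ F.0#) refl) (⟦⟧-yes (F.0# F.≟ F.0#) refl)))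
                  refl)
    off-origin (no e₁≢0) _ =
      subst ZeroOne (sym (trans (cong (λ i → ⟦ e₂ F.≟ (c F.* e₁) ⟧ - (1ℤ - 0ℤ) * (i * δF e₂)) (⟦⟧-no (e₁ F.≟ F.0#) e₁≢0))
                                (drop ⟦ e₂ F.≟ (c F.* e₁) ⟧ (δF e₂))))
            (zeroOne-⟦⟧ (e₂ F.≟ (c F.* e₁)))
      where
      drop : ∀ n i → n - (1ℤ - 0ℤ) * (0ℤ * i) ≡ n
      drop = solve-∀
    off-origin (yes _) (no e₂≢0) =
      subst ZeroOne (sym (trans (cong (λ i → ⟦ e₂ F.≟ (c F.* e₁) ⟧ - (1ℤ - 0ℤ) * (δF e₁ * i)) (⟦⟧-no (e₂ F.≟ F.0#) e₂≢0))
                                (drop ⟦ e₂ F.≟ (c F.* e₁) ⟧ (δF e₁))))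
            (zeroOne-⟦⟧ (e₂ F.≟ (c F.* e₁)))
      where
      drop : ∀ n i → n - (1ℤ - 0ℤ) * (i * 0ℤ) ≡ n
      drop = solve-∀

  zeroOne-Ã : ∀ k u → ZeroOne (Ã k u)
  zeroOne-Ã c0 (d , e₁ , e₂) = zeroOne-* (zeroOne-⟦⟧ (d G.≟ G.0#)) (zeroOne-* (zeroOne-⟦⟧ (e₁ F.≟ F.0#)) (zeroOne-⟦⟧ (e₂ F.≟ F.0#)))
  zeroOne-Ã c1 (d , e₁ , e₂) =
    zeroOne-* (zeroOne-⟦⟧ (d G.≟ G.0#)) (zeroOne-* (zeroOne-⟦⟧ (e₁ F.≟ F.0#)) (zeroOne-1- (zeroOne-⟦⟧ (e₂ F.≟ F.0#))))
  zeroOne-Ã c2 (d , e₁ , e₂) = zeroOne-* (zeroOne-⟦⟧ (d G.≟ G.0#)) (zeroOne-* (zeroOne-1- (zeroOne-⟦⟧ (e₁ F.≟ F.0#))) (inj₂ refl))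
  zeroOne-Ã c3 (d , e₁ , e₂) =
    zeroOne-* (zeroOne-1- (zeroOne-⟦⟧ (d G.≟ G.0#))) (zeroOne-* (zeroOne-⟦⟧ (e₁ F.≟ F.0#)) (zeroOne-⟦⟧ (e₂ F.≟ F.0#)))
  zeroOne-Ã c4 (d , e₁ , e₂) =
    zeroOne-* (zeroOne-1- (zeroOne-⟦⟧ (d G.≟ G.0#))) (zeroOne-* (zeroOne-⟦⟧ (e₁ F.≟ F.0#)) (zeroOne-1- (zeroOne-⟦⟧ (e₂ F.≟ F.0#))))
  zeroOne-Ã (c5 β p) u = zeroOne-A₅ β (nonZero-of β p) u

  zero-one : ∀ i x y → ZeroOne (A i x y)
  zero-one i x y = subst ZeroOne (sym (A-diff i x y)) (zeroOne-Ã i (diff x y))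

  A₀≡I : ∀ x y → A c0 x y ≡ Iₘ TX x y
  A₀≡I x@(b , a₁ , a₂) y@(b' , a₁' , a₂') with FinType._≟_ TX x y
  ... | yes refl = cong₂ _*_ (⟦⟧-yes (b G.≟ b) refl)
                         (cong₂ _*_ (⟦⟧-yes (a₁ F.≟ a₁) refl) (⟦⟧-yes (a₂ F.≟ a₂) refl))
  ... | no x≢y with b G.≟ b' | a₁ F.≟ a₁' | a₂ F.≟ a₂'
  ...   | yes refl | yes refl | yes refl = ⊥-elim (x≢y refl)
  ...   | no _     | _        | _        = ℤP.*-zeroˡ (⟦ a₁ F.≟ a₁' ⟧ * ⟦ a₂ F.≟ a₂' ⟧)
  ...   | yes _    | no _     | _        = cong (1ℤ *_) (ℤP.*-zeroˡ ⟦ a₂ F.≟ a₂' ⟧)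
  ...   | yes _    | yes _    | no _     = refl

  all-one : Kron6
  all-one = ⟨ 1ℤ , 1ℤ , 1ℤ , 1ℤ , 1ℤ , 1ℤ ⟩

  sum≡J : ∀ x y → Σ-list classes (λ i → A i x y) ≡ Jₘ TX x y
  sum≡J x y =
    begin
      Σ-list classes (λ k → A k x y)
    ≡⟨ Σ-cong classes (λ k → trans (sym (ℤP.*-identityˡ (A k x y))) (cong (_* A k x y) (sym (coefficient-one k)))) ⟩
      Σ-list classes (λ k → coeffs all-one [] k * A k x y)
    ≡⟨ Σ-cong classes (λ k → cong (coeffs all-one [] k *_) (A-diff k x y)) ⟩
      Σ-list classes (λ k → coeffs all-one [] k * Ã k (diff x y))
    ≡⟨ combination all-one [] [] (diff x y) ⟩
      all-one · vanishing (diff x y) + 0ℤ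
    ≡⟨ partition (δG (proj₁ (diff x y))) (δF (proj₁ (proj₂ (diff x y)))) (δF (proj₂ (proj₂ (diff x y)))) ⟩
      1ℤ
    ∎
    where
    open ≡-Reasoning
    coefficient-one : ∀ k → coeffs all-one [] k ≡ 1ℤ
    coefficient-one c0 = refl
    coefficient-one c1 = refl
    coefficient-one c2 = refl
    coefficient-one c3 = refl
    coefficient-one c4 = refl
    coefficient-one (c5 _ _) = refl
    partition : ∀ D E₁ E₂ → 1ℤ * (D * (E₁ * E₂)) + 1ℤ * (D * (E₁ * (1ℤ - E₂))) + 1ℤ * (D * ((1ℤ - E₁) * 1ℤ))
                            + 1ℤ * ((1ℤ - D) * (E₁ * E₂)) + 1ℤ * ((1ℤ - D) * (E₁ * (1ℤ - E₂))) + 1ℤ * ((1ℤ - D) * (1ℤ - E₁)) + 0ℤ ≡ 1ℤ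
    partition = solve-∀

  origin : Pt
  origin = (G.0# , F.0# , F.0#)

  ⟦0≟1⟧G : ⟦ G.0# G.≟ G.1# ⟧ ≡ 0ℤ
  ⟦0≟1⟧G = ⟦⟧-no (G.0# G.≟ G.1#) G.0≢1

  ⟦0≟1⟧F : ⟦ F.0# F.≟ F.1# ⟧ ≡ 0ℤ
  ⟦0≟1⟧F = ⟦⟧-no (F.0# F.≟ F.1#) F.0≢1

  ⟦0≟0⟧G : ⟦ G.0# G.≟ G.0# ⟧ ≡ 1ℤ
  ⟦0≟0⟧G = ⟦⟧-yes (G.0# G.≟ G.0#) refl

  ⟦0≟0⟧F : ⟦ F.0# F.≟ F.0# ⟧ ≡ 1ℤ
  ⟦0≟0⟧F = ⟦⟧-yes (F.0# F.≟ F.0#) refl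

  nonzero-by : ∀ i x y → A i x y ≡ 1ℤ → ∃[ x ] ∃[ y ] (¬ (A i x y ≡ 0ℤ))
  nonzero-by i x y e = x , y , λ e' → 1≢0 (trans (sym e) e')
    where
    1≢0 : ¬ (1ℤ ≡ 0ℤ)
    1≢0 ()

  nonzero : ∀ i → ∃[ x ] ∃[ y ] (¬ (A i x y ≡ 0ℤ))
  nonzero c0 = nonzero-by c0 origin origin
    (cong₂ _*_ ⟦0≟0⟧G (cong₂ _*_ ⟦0≟0⟧F ⟦0≟0⟧F))
  nonzero c1 = nonzero-by c1 origin (G.0# , F.0# , F.1#)
    (cong₂ _*_ ⟦0≟0⟧G (cong₂ _*_ ⟦0≟0⟧F (cong (λ i → 1ℤ - i) ⟦0≟1⟧F)))
  nonzero c2 = nonzero-by c2 origin (G.0# , F.1# , F.0#)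
    (cong₂ _*_ ⟦0≟0⟧G (cong (λ i → (1ℤ - i) * 1ℤ) ⟦0≟1⟧F))
  nonzero c3 = nonzero-by c3 origin (G.1# , F.0# , F.0#)
    (cong₂ _*_ (cong (λ i → 1ℤ - i) ⟦0≟1⟧G) (cong₂ _*_ ⟦0≟0⟧F ⟦0≟0⟧F))
  nonzero c4 = nonzero-by c4 origin (G.1# , F.0# , F.1#)
    (cong₂ _*_ (cong (λ i → 1ℤ - i) ⟦0≟1⟧G) (cong₂ _*_ ⟦0≟0⟧F (cong (λ i → 1ℤ - i) ⟦0≟1⟧F)))
  nonzero (c5 β p) = on-line (φ→ (β G.* (G.1# G.- G.0#))) refl
    where
    -- the point (1, 1, c) on the line of slope c = φ(β) through the origin
    on-line : ∀ m → φ→ (β G.* (G.1# G.- G.0#)) ≡ m → ∃[ x ] ∃[ y ] (¬ (A (c5 β p) x y ≡ 0ℤ))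
    on-line nothing eq = ⊥-elim (G.*-nonZero (nonZero-of β p) 1-0≢0 (φ-injective (trans eq (sym φ-0))))
      where
      1-0≢0 : G.NonZero (G.1# G.- G.0#)
      1-0≢0 e = G.1≢0 (G.x-y≡0⇒x≡y G.1# G.0# e)
    on-line (just c) eq = nonzero-by (c5 β p) origin (G.1# , F.1# , c) (cong₂ _-_ incident off-diagonal)
      where
      incident : N β origin (G.1# , F.1# , c) ≡ 1ℤ
      incident = trans (N-diff β G.0# F.0# F.0# G.1# F.1# c)
                       (trans (cong (λ m → slopeIncidence m (F.1# F.- F.0#) (c F.- F.0#)) eq)
                              (⟦⟧-yes ((c F.- F.0#) F.≟ (c F.* (F.1# F.- F.0#)))
                                      (F.solve 1 (λ c → c F.:- F.con (ℤ.+ 0) F.:= c F.:* (F.con (ℤ.+ 1) F.:- F.con (ℤ.+ 0))) refl c)))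
      off-diagonal : A₃ origin (G.1# , F.1# , c) ≡ 0ℤ
      off-diagonal = trans (cong₂ _*_ (cong (λ i → 1ℤ - i) ⟦0≟1⟧G) (cong (_* ⟦ F.0# F.≟ c ⟧) ⟦0≟1⟧F)) refl

  ⟦⟧-symG : ∀ b b' → ⟦ b' G.≟ b ⟧ ≡ ⟦ b G.≟ b' ⟧
  ⟦⟧-symG b b' = ⟦⟧-iff (b' G.≟ b) (b G.≟ b') sym sym

  ⟦⟧-symF : ∀ a a' → ⟦ a' F.≟ a ⟧ ≡ ⟦ a F.≟ a' ⟧
  ⟦⟧-symF a a' = ⟦⟧-iff (a' F.≟ a) (a F.≟ a') sym sym

  Kron-symmetric : ∀ k x y → A (cls k) y x ≡ A (cls k) x y
  Kron-symmetric kc0 (b , a₁ , a₂) (b' , a₁' , a₂') rewrite ⟦⟧-symG b b' | ⟦⟧-symF a₁ a₁' | ⟦⟧-symF a₂ a₂' = refl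
  Kron-symmetric kc1 (b , a₁ , a₂) (b' , a₁' , a₂') rewrite ⟦⟧-symG b b' | ⟦⟧-symF a₁ a₁' | ⟦⟧-symF a₂ a₂' = refl
  Kron-symmetric kc2 (b , a₁ , a₂) (b' , a₁' , a₂') rewrite ⟦⟧-symG b b' | ⟦⟧-symF a₁ a₁' = refl
  Kron-symmetric kc3 (b , a₁ , a₂) (b' , a₁' , a₂') rewrite ⟦⟧-symG b b' | ⟦⟧-symF a₁ a₁' | ⟦⟧-symF a₂ a₂' = refl
  Kron-symmetric kc4 (b , a₁ , a₂) (b' , a₁' , a₂') rewrite ⟦⟧-symG b b' | ⟦⟧-symF a₁ a₁' | ⟦⟧-symF a₂ a₂' = refl

  slopeIncidence-reverse : ∀ m a₁ a₂ a₁' a₂' → slopeIncidence m (a₁ F.- a₁') (a₂ F.- a₂') ≡ slopeIncidence m (a₁' F.- a₁) (a₂' F.- a₂)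
  slopeIncidence-reverse nothing a₁ a₂ a₁' a₂' = refl
  slopeIncidence-reverse (just c) a₁ a₂ a₁' a₂' =
    ⟦⟧-iff ((a₂ F.- a₂') F.≟ (c F.* (a₁ F.- a₁'))) ((a₂' F.- a₂) F.≟ (c F.* (a₁' F.- a₁)))
      (F.≡-by-multiple (F.- F.1#) (negate a₁ a₂ a₁' a₂' c)) (F.≡-by-multiple (F.- F.1#) (negate a₁' a₂' a₁ a₂ c))
    where
    negate : ∀ a₁ a₂ a₁' a₂' c → (a₂' F.- a₂) F.- c F.* (a₁' F.- a₁) ≡ (F.- F.1#) F.* ((a₂ F.- a₂') F.- c F.* (a₁ F.- a₁'))
    negate = F.solve 5 (λ a₁ a₂ a₁' a₂' c → (a₂' F.:- a₂) F.:- c F.:* (a₁' F.:- a₁)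
                          F.:= (F.:- F.con (ℤ.+ 1)) F.:* ((a₂ F.:- a₂') F.:- c F.:* (a₁ F.:- a₁'))) refl

  N-transpose : ∀ β x y → N β y x ≡ N (G.- β) x y
  N-transpose β (b , a₁ , a₂) (b' , a₁' , a₂') =
    begin
      N β (b' , a₁' , a₂') (b , a₁ , a₂)
    ≡⟨ N-diff β b' a₁' a₂' b a₁ a₂ ⟩
      slopeIncidence (φ→ (β G.* (b G.- b'))) (a₁ F.- a₁') (a₂ F.- a₂')
    ≡⟨ cong (λ w → slopeIncidence (φ→ w) (a₁ F.- a₁') (a₂ F.- a₂'))
            (G.solve 3 (λ β b b' → β G.:* (b G.:- b') G.:= (G.:- β) G.:* (b' G.:- b)) refl β b b') ⟩
      slopeIncidence (φ→ ((G.- β) G.* (b' G.- b))) (a₁ F.- a₁') (a₂ F.- a₂')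
    ≡⟨ slopeIncidence-reverse (φ→ ((G.- β) G.* (b' G.- b))) a₁ a₂ a₁' a₂' ⟩
      slopeIncidence (φ→ ((G.- β) G.* (b' G.- b))) (a₁' F.- a₁) (a₂' F.- a₂)
    ≡⟨ sym (N-diff (G.- β) b a₁ a₂ b' a₁' a₂') ⟩
      N (G.- β) (b , a₁ , a₂) (b' , a₁' , a₂')
    ∎
    where open ≡-Reasoning

  transpose : ∀ i → ¬ (i ≡ c0) → ∃[ j ] (¬ (j ≡ c0) × (∀ x y → (A i ᵀ) x y ≡ A j x y))
  transpose i i≢c0 with view i
  ... | kron k = cls k , i≢c0 , Kron-symmetric k
  ... | a₅ β p = c5 (G.- β) (fromWitnessFalse (G.-‿nonZero (nonZero-of β p))) , (λ ()) ,
                 λ x y → cong₂ _-_ (N-transpose β x y) (Kron-symmetric kc3 x y)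

theorem4p3 : (Fq Fq1 : FiniteField)
    → FiniteField.order Fq1 ≡ suc (FiniteField.order Fq)
    → (φ : FiniteField.Carrier Fq1 ↔ Maybe (FiniteField.Carrier Fq))
    → Inverse.to φ (FiniteField.0# Fq1) ≡ nothing
    → IsCommAssocScheme (Construction.TX Fq Fq1 φ) (Construction.Cls Fq Fq1 φ)
        (Construction.classes Fq Fq1 φ) (Construction.c0)
        (Construction.A Fq Fq1 φ) (FiniteField.order Fq ℕ.+ 4)
theorem4p3 Fq Fq1 order-Fq1 φ φ-0 = record
  { idxs-complete = classes-complete
  ; idxs-unique = classes-unique
  ; #classes = #classes
  ; zero-one = zero-one
  ; nonzero = nonzero
  ; A₀≡I = A₀≡I
  ; sum≡J = sum≡J
  ; transpose = transpose
  ; closed = closed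
  ; commute = commute
  }
  where open Scheme Fq Fq1 order-Fq1 φ φ-0
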